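{- Let $q$ be an odd prime power with $q\ge5$, and let $c\in\mathbb{F}_q^*$ be arbitrary. (i) Let $q\equiv1\pmod 3$ and let $d\in\mathbb{F}_q$ satisfy $d^2+d+1=0$. Then $$F(x)=\left(\left(\left(\left(\frac{ -x}{d+1}\right)^{q-2}+c\right)^{q-2}+\frac{d}{c}\right)^{q-2}-\frac{c}{d+1}\right)^{q-2}+x$$ is a permutation of $\mathbb{F}_q$. Moreover, with $g(x)=-(d+1)x+(d^2+d)/c$, the map $f(x)=F(x)-x$ satisfies $f(x)=g(x)$ for $x\notin\{0,(d+1)/c,d/c\}$, $f(0)=g(d/c)=0$, $f((d+1)/c)=g(0)$ and $f(d/c)=g((d+1)/c)$. (ii) Let $q\equiv 5\pmod{12}$ and let $d\in\mathbb{F}_q$ satisfy $(d+1)^2=-1$. Then the map $F$ given by the same formula as in (i) has value set $V_F=\mathbb{F}_q\setminus\{d/c,(-d-2)/c\}$; the element $-1/c$ has exactly $3$ preimages under $F$, every other element of $V_F$ has exactly one preimage, and so the maximum count of $F$ is $3$. (iii) Let $q\equiv 11\pmod{12}$ and let $d\in\mathbb{F}_q\setminus\{ -1,-1/2,0\}$. Then $$F(x)=\left(\left(\left(\left(\frac{x}{d(d+1)}\right)^{q-2}+c\right)^{q-2}+\frac{d}{c}\right)^{q-2}-\frac{c}{d+1}\right)^{q-2}+x$$ has value set $V_F=\mathbb{F}_q\setminus\{d(d+1)/c,\,-(d+1)^2/c,\,-d^2/c\}$; the element $(-d^2-d-1)/c$ has exactly $2$ preimages, $0$ has exactly $3$ preimages,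 and each of the other $q-5$ elements of $V_F$ has exactly one preimage. Thus the maximum count is $3$, and exactly $3$ elements of $\mathbb{F}_q$ have no preimage, $q-5$ have exactly one, one has exactly two and one has exactly three.
   Context: For $y\in\mathbb{F}_q$, $y^{q-2}$ equals $y^{ -1}$ if $y\ne0$ and $0$ if $y=0$. The value set of $F$ is $V_F=\{F(x):x\in\mathbb{F}_q\}$; the maximum count of $F$ is $\max_{\beta\in\mathbb{F}_q}|F^{ -1}(\beta)|$. -}

module Defs where

open import Data.Nat using (ℕ; zero; suc; _∸_; _⊔_) renaming (_≟_ to _≟ℕ_)
open import Data.Fin using (Fin)
open import Data.List using (List; map; length; filter; foldr; allFin)
open import Data.Product using (∃)
open import Algebra.Core using (Op₁; Op₂)
open import Algebra.Structures using (IsCommutativeRing)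
open import Relation.Binary.PropositionalEquality using (_≡_; _≢_)
open import Relation.Binary.Definitions using (DecidableEquality)
open import Function.Bundles using (_↔_; Inverse)
open import Function.Definitions using (Bijective)

-- Decidable equality is
-- included for convenience (it follows from the bijection with Fin).
record FiniteField : Set₁ where
  infixl 6 _+_
  infixl 7 _*_
  infix  8 -_
  infix  9 _⁻¹
  field
    Carrier : Set
    _+_ _*_ : Op₂ Carrier
    -_ : Op₁ Carrier
    0# 1# : Carrier
    _⁻¹ : Op₁ Carrier
    isCommutativeRing : IsCommutativeRing _≡_ _+_ _*_ -_ 0# 1#
    0≢1 : 0# ≢ 1#
    ⁻¹-inverse : ∀ x → x ≢ 0# → x * (x ⁻¹) ≡ 1#
    _≟_ : DecidableEquality Carrier
    size : ℕ
    enum : Fin size ↔ Carrier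

module FF (K : FiniteField) where
  open FiniteField K public

  infixl 6 _-_
  infixl 7 _/_

  q : ℕ
  q = size

  _-_ : Op₂ Carrier
  x - y = x + (- y)

  -- field division (only used with nonzero denominators)
  _/_ : Op₂ Carrier
  x / y = x * (y ⁻¹)

  pow : Carrier → ℕ → Carrier
  pow x zero = 1#
  pow x (suc n) = x * pow x n

  pw : Carrier → Carrier
  pw y = pow y (q ∸ 2)

  elements : List Carrier
  elements = map (Inverse.to enum) (allFin size)

  IsPermutation : (Carrier → Carrier) → Set
  IsPermutation F = Bijective _≡_ _≡_ F

  InValueSet : (Carrier → Carrier) → Carrier → Set
  InValueSet F β = ∃ λ x → F x ≡ β

  preimageCount : (Carrier → Carrier) → Carrier → ℕ
  preimageCount F β = length (filter (λ x → F x ≟ β) elements)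

  maxCount : (Carrier → Carrier) → ℕ
  maxCount F = foldr _⊔_ 0 (map (preimageCount F) elements)

  numWithCount : (Carrier → Carrier) → ℕ → ℕ
  numWithCount F k = length (filter (λ β → preimageCount F β ≟ℕ k) elements)

  F₁ : Carrier → Carrier → Carrier → Carrier
  F₁ c d x = pw (pw (pw (pw ((- x) / (d + 1#)) + c) + d / c) - c / (d + 1#)) + x

  F₃ : Carrier → Carrier → Carrier → Carrier
  F₃ c d x = pw (pw (pw (pw (x / (d * (d + 1#))) + c) + d / c) - c / (d + 1#)) + x

module Submission where

open import Defs
open import Data.Nat using (ℕ; _≤_; _%_; _^_; _∸_)
open import Data.Nat.Primality using (Prime)
open import Data.Product using (_×_; ∃; ∃₂)
open import Relation.Binary.PropositionalEquality using (_≡_; _≢_)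
open import Function.Bundles using (_⇔_)
open import Data.Nat using (s≤s; z≤n)
open import Data.Nat.Properties using (≤-trans)
open import Data.Product using (_,_)
open import Algebra.Bundles using (CommutativeRing)

-- Away from three exceptional points every inversion y ↦ y ^ (q - 2) in the chain defining F is a genuine
-- inverse (Fermat), and the composite of the four Möbius maps degenerates, thanks to the relation on d, into an
-- affine bijection L. So F agrees with L outside a three-point set S, and β has as many preimages as there are
-- s ∈ S with F s = β, plus one if β ∉ L(S). Evaluating F and L on S yields the value sets and all preimage
-- counts; the nonvanishing of the constants in (iii) uses that for q ≡ 11 (mod 12) the field contains neither
-- a square root of -1 nor a primitive cube root of unity.

module IntegerCoefficientRingSolver {c ℓ} (R : CommutativeRing c ℓ) where

  open import Data.Nat as ℕ using (ℕ; zero; suc)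
  import Data.Nat.Properties as ℕ
  open import Data.Integer as ℤ using (ℤ; +_; -[1+_]; _⊖_)
  import Data.Integer.Properties as ℤ
  open import Data.Sign as Sign using (Sign)
  open import Data.Maybe using (Maybe; just; nothing)
  open import Relation.Binary.PropositionalEquality.Core as ≡ using (_≡_)
  open import Relation.Nullary using (yes; no)
  open import Algebra.Solver.Ring.AlmostCommutativeRing
    using (fromCommutativeRing; _-Raw-AlmostCommutative⟶_)

  open CommutativeRing R
  open import Algebra.Properties.Ring ring using (-1*x≈-x; -‿+-comm; -0#≈0#; -‿involutive)
  open import Algebra.Properties.CommutativeSemigroup *-commutativeSemigroup using (interchange)
  open import Algebra.Properties.Semiring.Mult.TCOptimised semiring
    using (×-homo-+; ×1-homo-*) renaming (_×_ to _×′_)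
  open import Relation.Binary.Reasoning.Setoid setoid

  -- The library's reflective solver uses the ring itself for coefficients, whose arithmetic does not compute for
  -- an abstract ring; with integer coefficients the normal forms of both sides compare by evaluation.
  fromℤ : ℤ → Carrier
  fromℤ (+ n) = n ×′ 1#
  fromℤ -[1+ n ] = - (suc n ×′ 1#)

  private
    suc×′1 : ∀ n → suc n ×′ 1# ≈ n ×′ 1# + 1#
    suc×′1 n = trans (reflexive (≡.cong (_×′ 1#) (ℕ.+-comm 1 n))) (×-homo-+ 1# n 1)

    [x+1]-[y+1]≈x-y : ∀ x y → (x + 1#) - (y + 1#) ≈ x - y
    [x+1]-[y+1]≈x-y x y = begin
      (x + 1#) - (y + 1#)     ≈⟨ +-congˡ (-‿+-comm y 1#) ⟨
      (x + 1#) + (- y - 1#)   ≈⟨ +-congˡ (+-comm (- y) (- 1#)) ⟩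
      (x + 1#) + (- 1# - y)   ≈⟨ +-assoc x 1# _ ⟩
      x + (1# + (- 1# - y))   ≈⟨ +-congˡ (+-assoc 1# (- 1#) (- y)) ⟨
      x + ((1# - 1#) - y)     ≈⟨ +-congˡ (+-congʳ (-‿inverseʳ 1#)) ⟩
      x + (0# - y)            ≈⟨ +-congˡ (+-identityˡ (- y)) ⟩
      x - y                   ∎

    ⊖-homo : ∀ m n → fromℤ (m ⊖ n) ≈ m ×′ 1# - n ×′ 1#
    ⊖-homo m zero = begin
      fromℤ (m ⊖ 0)     ≈⟨ +-identityʳ _ ⟨
      m ×′ 1# + 0#      ≈⟨ +-congˡ -0#≈0# ⟨
      m ×′ 1# - 0#      ∎
    ⊖-homo zero (suc n) = sym (+-identityˡ _)
    ⊖-homo (suc m) (suc n) = begin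
      fromℤ (suc m ⊖ suc n)                ≡⟨ ≡.cong fromℤ (ℤ.[1+m]⊖[1+n]≡m⊖n m n) ⟩
      fromℤ (m ⊖ n)                        ≈⟨ ⊖-homo m n ⟩
      m ×′ 1# - n ×′ 1#                    ≈⟨ [x+1]-[y+1]≈x-y _ _ ⟨
      (m ×′ 1# + 1#) - (n ×′ 1# + 1#)      ≈⟨ +-cong (suc×′1 m) (-‿cong (suc×′1 n)) ⟨
      suc m ×′ 1# - suc n ×′ 1#            ∎

    +-homo : ∀ i j → fromℤ (i ℤ.+ j) ≈ fromℤ i + fromℤ j
    +-homo (+ m) (+ n) = ×-homo-+ 1# m n
    +-homo (+ m) -[1+ n ] = ⊖-homo m (suc n)
    +-homo -[1+ m ] (+ n) = trans (⊖-homo n (suc m)) (+-comm _ _)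
    +-homo -[1+ m ] -[1+ n ] = begin
      - (suc (suc (m ℕ.+ n)) ×′ 1#)           ≡⟨ ≡.cong (λ k → - (suc k ×′ 1#)) (≡.sym (ℕ.+-suc m n)) ⟩
      - ((suc m ℕ.+ suc n) ×′ 1#)             ≈⟨ -‿cong (×-homo-+ 1# (suc m) (suc n)) ⟩
      - (suc m ×′ 1# + suc n ×′ 1#)           ≈⟨ -‿+-comm _ _ ⟨
      - (suc m ×′ 1#) - suc n ×′ 1#           ∎

    -‿homo : ∀ i → fromℤ (ℤ.- i) ≈ - fromℤ i
    -‿homo (+ zero) = sym -0#≈0#
    -‿homo (+ suc n) = refl
    -‿homo -[1+ n ] = sym (-‿involutive _)

    fromSign : Sign → Carrier
    fromSign Sign.+ = 1#
    fromSign Sign.- = - 1#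

    ◃-homo : ∀ s n → fromℤ (s ℤ.◃ n) ≈ fromSign s * n ×′ 1#
    ◃-homo s zero = sym (zeroʳ _)
    ◃-homo Sign.+ (suc n) = sym (*-identityˡ _)
    ◃-homo Sign.- (suc n) = sym (-1*x≈-x _)

    fromSign-homo : ∀ s t → fromSign (s Sign.* t) ≈ fromSign s * fromSign t
    fromSign-homo Sign.+ t = sym (*-identityˡ _)
    fromSign-homo Sign.- Sign.+ = sym (*-identityʳ _)
    fromSign-homo Sign.- Sign.- = begin
      1#           ≈⟨ -‿involutive 1# ⟨
      - - 1#       ≈⟨ -1*x≈-x (- 1#) ⟨
      - 1# * - 1#  ∎

    sign-abs : ∀ i → fromℤ i ≈ fromSign (ℤ.sign i) * ℤ.∣ i ∣ ×′ 1#
    sign-abs i = trans (reflexive (≡.cong fromℤ (≡.sym (ℤ.◃-inverse i)))) (◃-homo (ℤ.sign i) ℤ.∣ i ∣)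

    *-homo : ∀ i j → fromℤ (i ℤ.* j) ≈ fromℤ i * fromℤ j
    *-homo i j = begin
      fromℤ (i ℤ.* j)                                                ≈⟨ ◃-homo (s Sign.* t) (m ℕ.* n) ⟩
      fromSign (s Sign.* t) * (m ℕ.* n) ×′ 1#                         ≈⟨ *-cong (fromSign-homo s t) (×1-homo-* m n) ⟩
      (fromSign s * fromSign t) * (m ×′ 1# * n ×′ 1#)                 ≈⟨ interchange _ _ _ _ ⟩
      (fromSign s * m ×′ 1#) * (fromSign t * n ×′ 1#)                 ≈⟨ *-cong (sign-abs i) (sign-abs j) ⟨
      fromℤ i * fromℤ j                                              ∎
      where
      s t : Sign
      s = ℤ.sign i
      t = ℤ.sign j
      m n : ℕ
      m = ℤ.∣ i ∣
      n = ℤ.∣ j ∣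

  ℤ-morphism : ℤ.+-*-rawRing -Raw-AlmostCommutative⟶ fromCommutativeRing R
  ℤ-morphism = record
    { ⟦_⟧ = fromℤ ; +-homo = +-homo ; *-homo = *-homo ; -‿homo = -‿homo ; 0-homo = refl ; 1-homo = refl }

  private
    coefficient≟ : ∀ i j → Maybe (fromℤ i ≈ fromℤ j)
    coefficient≟ i j with i ℤ.≟ j
    ... | yes ≡.refl = just refl
    ... | no _ = nothing

  open import Algebra.Solver.Ring ℤ.+-*-rawRing (fromCommutativeRing R) ℤ-morphism coefficient≟
    using (Polynomial; solve; _:=_; con; _:+_; _:*_; :-_; _:-_) public

module Counting where

  open import Level using (0ℓ)
  open import Data.Empty using (⊥-elim)
  open import Data.Nat using (ℕ; suc; _+_)
  open import Data.Nat.Properties using (+-suc; +-identityʳ; +-assoc)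
  open import Data.Product using (_×_; _,_)
  open import Data.List using (List; []; _∷_; length; filter; map)
  open import Data.List.Properties using (filter-none)
  open import Data.List.Relation.Unary.All as All using (All)
  open import Data.List.Relation.Unary.Any using (here; there)
  open import Data.List.Membership.Propositional using (_∈_; _∉_)
  open import Data.List.Membership.Propositional.Properties using (∈-filter⁺; ∈-filter⁻)
  open import Data.List.Membership.Propositional.Properties.WithK using (unique∧set⇒bag)
  open import Data.List.Relation.Unary.Unique.Propositional using (Unique; []; _∷_)
  import Data.List.Relation.Unary.Unique.Propositional.Properties as Unique
  open import Data.List.Relation.Binary.BagAndSetEquality using (∼bag⇒↭)
  open import Data.List.Relation.Binary.Permutation.Propositional.Properties using (↭-length)
  open import Function using (_∘_)
  open import Function.Bundles using (_⇔_; mk⇔; Equivalence)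
  open import Relation.Nullary using (Dec; yes; no; ¬_)
  open import Relation.Nullary.Decidable using (¬?)
  open import Relation.Unary using (Pred; Decidable; ∁)
  open import Relation.Binary.PropositionalEquality
  open import Relation.Binary.Definitions using (DecidableEquality)

  𝟙 : {B : Set} → Dec B → ℕ
  𝟙 (yes _) = 1
  𝟙 (no _) = 0

  𝟙-yes : {B : Set} (B? : Dec B) → B → 𝟙 B? ≡ 1
  𝟙-yes (yes _) _ = refl
  𝟙-yes (no ¬b) b = ⊥-elim (¬b b)

  𝟙-no : {B : Set} (B? : Dec B) → ¬ B → 𝟙 B? ≡ 0
  𝟙-no (yes b) ¬b = ⊥-elim (¬b b)
  𝟙-no (no _) _ = refl

  𝟙-⇔ : {B C : Set} (B? : Dec B) (C? : Dec C) → B ⇔ C → 𝟙 B? ≡ 𝟙 C?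
  𝟙-⇔ (yes b) C? B⇔C = sym (𝟙-yes C? (Equivalence.to B⇔C b))
  𝟙-⇔ (no ¬b) C? B⇔C = sym (𝟙-no C? (λ c → ¬b (Equivalence.from B⇔C c)))

  count : {A : Set} {P : Pred A 0ℓ} → Decidable P → List A → ℕ
  count P? xs = length (filter P? xs)

  module _ {A : Set} {P : Pred A 0ℓ} (P? : Decidable P) where

    count-∷ : ∀ x xs → count P? (x ∷ xs) ≡ 𝟙 (P? x) + count P? xs
    count-∷ x xs with P? x
    ... | yes _ = refl
    ... | no _ = refl

    count-map : {B : Set} (f : B → A) (xs : List B) → count (λ x → P? (f x)) xs ≡ count P? (map f xs)
    count-map f [] = refl
    count-map f (x ∷ xs) with P? (f x)
    ... | yes _ = cong suc (count-map f xs)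
    ... | no _ = count-map f xs

    count-none : ∀ {xs} → All (∁ P) xs → count P? xs ≡ 0
    count-none ¬Pxs = cong length (filter-none P? ¬Pxs)

    count-+-count-∁ : ∀ xs → count P? xs + count (¬? ∘ P?) xs ≡ length xs
    count-+-count-∁ [] = refl
    count-+-count-∁ (x ∷ xs) with P? x
    ... | yes _ = cong suc (count-+-count-∁ xs)
    ... | no _ = trans (+-suc _ _) (cong suc (count-+-count-∁ xs))

    count-≡-length : ∀ {xs ys} → Unique xs → Unique ys → (∀ {x} → (x ∈ xs × P x) ⇔ x ∈ ys) →
                     count P? xs ≡ length ys
    count-≡-length {xs} {ys} xs! ys! members =
      ↭-length (∼bag⇒↭ (unique∧set⇒bag (Unique.filter⁺ P? xs!) ys! (mk⇔ to from)))
      where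
      to : ∀ {x} → x ∈ filter P? xs → x ∈ ys
      to x∈ = Equivalence.to members (∈-filter⁻ P? x∈)
      from : ∀ {x} → x ∈ ys → x ∈ filter P? xs
      from x∈ys = let (x∈xs , Px) = Equivalence.from members x∈ys in ∈-filter⁺ P? x∈xs Px

  ∉₃ : {A : Set} {x a b c : A} → x ≢ a → x ≢ b → x ≢ c → x ∉ a ∷ b ∷ c ∷ []
  ∉₃ x≢a _ _ (here x≡a) = x≢a x≡a
  ∉₃ _ x≢b _ (there (here x≡b)) = x≢b x≡b
  ∉₃ _ _ x≢c (there (there (here x≡c))) = x≢c x≡c

  ∈-rotate : {A : Set} {a b c y : A} → y ∈ a ∷ b ∷ c ∷ [] ⇔ y ∈ c ∷ a ∷ b ∷ []
  ∈-rotate = mk⇔ (λ { (here e) → there (here e) ; (there (here e)) → there (there (here e)) ; (there (there (here e))) → here e })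
                 (λ { (here e) → there (there (here e)) ; (there (here e)) → here e ; (there (there (here e))) → there (here e) })

  module _ {A : Set} (_≟_ : DecidableEquality A) where
    open import Data.List.Membership.DecPropositional _≟_ using (_∈?_; _∉?_)

    count-≟₃ : ∀ {a b c} β → count (_≟ β) (a ∷ b ∷ c ∷ []) ≡ 𝟙 (a ≟ β) + 𝟙 (b ≟ β) + 𝟙 (c ≟ β)
    count-≟₃ {a} {b} {c} β = begin
      count (_≟ β) (a ∷ b ∷ c ∷ [])                          ≡⟨ count-∷ (_≟ β) a _ ⟩
      𝟙 (a ≟ β) + count (_≟ β) (b ∷ c ∷ [])                  ≡⟨ cong (𝟙 (a ≟ β) +_) (count-∷ (_≟ β) b _) ⟩
      𝟙 (a ≟ β) + (𝟙 (b ≟ β) + count (_≟ β) (c ∷ []))       ≡⟨ cong (λ n → 𝟙 (a ≟ β) + (𝟙 (b ≟ β) + n)) (trans (count-∷ (_≟ β) c _) (+-identityʳ _)) ⟩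
      𝟙 (a ≟ β) + (𝟙 (b ≟ β) + 𝟙 (c ≟ β))                   ≡⟨ sym (+-assoc (𝟙 (a ≟ β)) _ _) ⟩
      𝟙 (a ≟ β) + 𝟙 (b ≟ β) + 𝟙 (c ≟ β)                     ∎
      where open ≡-Reasoning

    count-≟+𝟙∉≡1 : ∀ {vs ws} → Unique vs → (∀ {y} → y ∈ vs ⇔ y ∈ ws) → ∀ β → count (_≟ β) vs + 𝟙 (β ∉? ws) ≡ 1
    count-≟+𝟙∉≡1 {vs} {ws} vs! vs⇔ws β with β ∈? vs
    ... | yes β∈vs = cong₂ _+_
            (count-≡-length (_≟ β) vs! (All.[] ∷ []) (mk⇔ (λ { (_ , refl) → here refl }) (λ { (here refl) → β∈vs , refl })))
            (𝟙-no (β ∉? ws) (λ β∉ws → β∉ws (Equivalence.to vs⇔ws β∈vs)))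
    ... | no β∉vs = cong₂ _+_
            (count-none (_≟ β) (All.tabulate (λ {x} x∈vs x≡β → β∉vs (subst (_∈ vs) x≡β x∈vs))))
            (𝟙-yes (β ∉? ws) (λ β∈ws → β∉vs (Equivalence.from vs⇔ws β∈ws)))

module FiniteFieldFacts (K : FiniteField) where

  open import Level using (0ℓ)
  open import Data.Nat as ℕ using (ℕ; zero; suc; _∸_; _≤_; s≤s)
  import Data.Nat.Properties as ℕ
  open import Data.Nat.DivMod using (_%_; m≡m%n+[m/n]*n; m∣n⇒o%n%m≡o%m)
  open import Data.Nat.Divisibility using (divides)
  open import Data.Integer as ℤ using ()
  open import Data.Fin as Fin using (Fin; punchIn)
  open import Data.Fin.Properties using (punchInᵢ≢i)
  open import Data.Fin.Permutation using (Permutation)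
  open import Data.Empty using (⊥-elim)
  open import Data.List using (length; allFin)
  open import Data.List.Properties using (length-map; length-tabulate)
  open import Data.List.Membership.Propositional using (_∈_)
  open import Data.List.Membership.Propositional.Properties using (∈-map⁺; ∈-allFin)
  open import Data.List.Relation.Unary.Unique.Propositional using (Unique)
  import Data.List.Relation.Unary.Unique.Propositional.Properties as Unique
  open import Algebra.Bundles using (CommutativeRing; CommutativeMonoid)
  open import Function using (_∘_)
  open import Function.Bundles using (Inverse; mk↔ₛ′)
  open import Relation.Nullary using (yes; no)
  open import Relation.Binary.PropositionalEquality

  open FF K

  commutativeRing : CommutativeRing 0ℓ 0ℓ
  commutativeRing = record { isCommutativeRing = isCommutativeRing }

  open CommutativeRing commutativeRing public
    using (+-assoc; +-comm; +-identityˡ; +-identityʳ; -‿inverseˡ; -‿inverseʳ;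
           *-assoc; *-comm; *-identityˡ; *-identityʳ; zeroˡ; zeroʳ;
           +-commutativeMonoid; *-commutativeMonoid; ring)
  open import Algebra.Properties.Ring ring public using (+-cancelˡ; -0#≈0#)
  open import Algebra.Properties.Semiring.Mult.TCOptimised (CommutativeRing.semiring commutativeRing)
    using (×-homo-+; ×1-homo-*; ×ᵤ≈×) renaming (_×_ to _×′_)
  open IntegerCoefficientRingSolver commutativeRing public using (Polynomial; solve; _:=_; con; _:+_; _:*_; :-_; _:-_)
  open ≡-Reasoning

  ι : ℕ → Carrier
  ι n = n ×′ 1#

  infix 9 #_

  #_ : ∀ {n} → ℕ → Polynomial n
  # k = con (ℤ.+ k)

  -- The ring solver proves l = r + (a - b) * q as a polynomial identity; the relation a = b removes the extra term.
  modulo : ∀ {a b l r q} → a ≡ b → l ≡ r + (a - b) * q → l ≡ r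
  modulo {a} {b} {l} {r} {q} a≡b l≡ = begin
    l                  ≡⟨ l≡ ⟩
    r + (a - b) * q    ≡⟨ cong (λ t → r + (t - b) * q) a≡b ⟩
    r + (b - b) * q    ≡⟨ cong (λ t → r + t * q) (-‿inverseʳ b) ⟩
    r + 0# * q         ≡⟨ cong (r +_) (zeroˡ q) ⟩
    r + 0#             ≡⟨ +-identityʳ r ⟩
    r                  ∎

  modulo₀ : ∀ {a l r q} → a ≡ 0# → l ≡ r + a * q → l ≡ r
  modulo₀ {r = r} {q} refl l≡ = trans l≡ (trans (cong (r +_) (zeroˡ q)) (+-identityʳ r))

  private
    to : Fin q → Carrier
    to = Inverse.to enum

    from : Carrier → Fin q
    from = Inverse.from enum

  elements-complete : ∀ x → x ∈ elements
  elements-complete x = subst (_∈ elements) (Inverse.strictlyInverseˡ enum x) (∈-map⁺ to (∈-allFin (from x)))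

  elements-unique : Unique elements
  elements-unique = Unique.map⁺ to-injective (Unique.allFin⁺ q)
    where
    to-injective : ∀ {i j} → to i ≡ to j → i ≡ j
    to-injective {i} {j} eq = trans (sym (Inverse.strictlyInverseʳ enum i))
                                    (trans (cong from eq) (Inverse.strictlyInverseʳ enum j))

  elements-length : length elements ≡ q
  elements-length = trans (length-map to (allFin q)) (length-tabulate _)

  1≢0 : 1# ≢ 0#
  1≢0 eq = 0≢1 (sym eq)

  *-cancelʳ : ∀ {x y z} → z ≢ 0# → x * z ≡ y * z → x ≡ y
  *-cancelʳ {x} {y} {z} z≢0 eq = begin
    x                   ≡⟨ sym (*-identityʳ x) ⟩
    x * 1#              ≡⟨ cong (x *_) (sym (⁻¹-inverse z z≢0)) ⟩
    x * (z * z ⁻¹)      ≡⟨ sym (*-assoc x z _) ⟩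
    (x * z) * z ⁻¹      ≡⟨ cong (_* z ⁻¹) eq ⟩
    (y * z) * z ⁻¹      ≡⟨ *-assoc y z _ ⟩
    y * (z * z ⁻¹)      ≡⟨ cong (y *_) (⁻¹-inverse z z≢0) ⟩
    y * 1#              ≡⟨ *-identityʳ y ⟩
    y                   ∎

  *-≢0 : ∀ {x y} → x ≢ 0# → y ≢ 0# → x * y ≢ 0#
  *-≢0 {x} {y} x≢0 y≢0 xy≡0 = y≢0 (*-cancelʳ x≢0 (trans (*-comm y x) (trans xy≡0 (sym (zeroˡ x)))))

  *≡1⇒≢0 : ∀ {x y} → x * y ≡ 1# → x ≢ 0#
  *≡1⇒≢0 {x} {y} xy≡1 refl = 1≢0 (trans (sym xy≡1) (zeroˡ y))

  module SumOverField (M : CommutativeMonoid 0ℓ 0ℓ) where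
    open CommutativeMonoid M using (_≈_) renaming (Carrier to A; trans to ≈-trans; reflexive to ≈-reflexive)
    open import Algebra.Properties.CommutativeMonoid.Sum M using (sum; sum-permute; sum-cong-≗)

    Σ : (Carrier → A) → A
    Σ f = sum (f ∘ to)

    Σ-reindex : (h h⁻¹ : Carrier → Carrier) → (∀ y → h (h⁻¹ y) ≡ y) → (∀ y → h⁻¹ (h y) ≡ y) →
                ∀ f → Σ f ≈ Σ (f ∘ h)
    Σ-reindex h h⁻¹ hh⁻¹ h⁻¹h f =
      ≈-trans (sum-permute (f ∘ to) π) (≈-reflexive (sum-cong-≗ (λ i → cong f (Inverse.strictlyInverseˡ enum (h (to i))))))
      where
      π : Permutation q q
      π = mk↔ₛ′ (from ∘ h ∘ to) (from ∘ h⁻¹ ∘ to)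
            (λ i → trans (cong (from ∘ h) (Inverse.strictlyInverseˡ enum _)) (trans (cong from (hh⁻¹ _)) (Inverse.strictlyInverseʳ enum i)))
            (λ i → trans (cong (from ∘ h⁻¹) (Inverse.strictlyInverseˡ enum _)) (trans (cong from (h⁻¹h _)) (Inverse.strictlyInverseʳ enum i)))

  pow-+ : ∀ x m n → pow x (m ℕ.+ n) ≡ pow x m * pow x n
  pow-+ x zero n = sym (*-identityˡ _)
  pow-+ x (suc m) n = trans (cong (x *_) (pow-+ x m n)) (sym (*-assoc _ _ _))

  pow-* : ∀ x m n → pow x (m ℕ.* n) ≡ pow (pow x m) n
  pow-* x m zero = cong (pow x) (ℕ.*-zeroʳ m)
  pow-* x m (suc n) = begin
    pow x (m ℕ.* suc n)          ≡⟨ cong (pow x) (ℕ.*-suc m n) ⟩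
    pow x (m ℕ.+ m ℕ.* n)        ≡⟨ pow-+ x m (m ℕ.* n) ⟩
    pow x m * pow x (m ℕ.* n)    ≡⟨ cong (pow x m *_) (pow-* x m n) ⟩
    pow x m * pow (pow x m) n    ∎

  pow-1# : ∀ n → pow 1# n ≡ 1#
  pow-1# zero = refl
  pow-1# (suc n) = trans (*-identityˡ _) (pow-1# n)

  module _ where
    open SumOverField *-commutativeMonoid renaming (Σ to ∏; Σ-reindex to ∏-reindex)
    open import Algebra.Properties.CommutativeMonoid.Sum *-commutativeMonoid
      using (sum; sum-remove; sum-cong-≗; ∑-distrib-+)

    private
      ∏-cong : ∀ {f g} → (∀ y → f y ≡ g y) → ∏ f ≡ ∏ g
      ∏-cong f≗g = sum-cong-≗ (f≗g ∘ to)

      ∏-distrib : ∀ f g → ∏ (λ y → f y * g y) ≡ ∏ f * ∏ g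
      ∏-distrib f g = ∑-distrib-+ (f ∘ to) (g ∘ to)

      ∏-≢0 : ∀ f → (∀ y → f y ≢ 0#) → ∏ f ≢ 0#
      ∏-≢0 f f≢0 = vec (f ∘ to) (f≢0 ∘ to)
        where
        vec : ∀ {n} (t : Fin n → Carrier) → (∀ i → t i ≢ 0#) → sum t ≢ 0#
        vec {zero} t _ = 1≢0
        vec {suc n} t t≢0 = *-≢0 (t≢0 Fin.zero) (vec (t ∘ Fin.suc) (t≢0 ∘ Fin.suc))

      ∏-const-except : ∀ {n} x (t : Fin n → Carrier) i → t i ≡ 1# → (∀ j → j ≢ i → t j ≡ x) → sum t ≡ pow x (n ∸ 1)
      ∏-const-except {suc n} x t i tᵢ≡1 tⱼ≡x = begin
        sum t                                 ≡⟨ sum-remove {i = i} t ⟩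
        t i * sum (t ∘ punchIn i)             ≡⟨ cong₂ _*_ tᵢ≡1 (sum-cong-≗ (λ j → tⱼ≡x (punchIn i j) (punchInᵢ≢i i j))) ⟩
        1# * sum {n} (λ _ → x)                ≡⟨ *-identityˡ _ ⟩
        sum {n} (λ _ → x)                     ≡⟨ const n ⟩
        pow x n                               ∎
        where
        const : ∀ n → sum {n} (λ _ → x) ≡ pow x n
        const zero = refl
        const (suc n) = cong (x *_) (const n)

    -- Fermat: multiplying by x permutes the field, and the product of the "nonzero parts" of all
    -- elements is unchanged by this, but picks up one factor x from every nonzero element.
    pow-q∸1≡1 : ∀ {x} → x ≢ 0# → pow x (q ∸ 1) ≡ 1#
    pow-q∸1≡1 {x} x≢0 = *-cancelʳ (∏-≢0 nonzeroPart nonzeroPart-≢0) (begin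
      pow x (q ∸ 1) * ∏ nonzeroPart                 ≡⟨ cong (_* ∏ nonzeroPart) (sym ∏-factor) ⟩
      ∏ factor * ∏ nonzeroPart                      ≡⟨ sym (∏-distrib factor nonzeroPart) ⟩
      ∏ (λ y → factor y * nonzeroPart y)            ≡⟨ sym (∏-cong nonzeroPart-x*) ⟩
      ∏ (λ y → nonzeroPart (x * y))                 ≡⟨ sym (∏-reindex (x *_) (x ⁻¹ *_) x*[x⁻¹*y] x⁻¹*[x*y] nonzeroPart) ⟩
      ∏ nonzeroPart                                 ≡⟨ sym (*-identityˡ _) ⟩
      1# * ∏ nonzeroPart                            ∎)
      where
      nonzeroPart : Carrier → Carrier
      nonzeroPart y with y ≟ 0#
      ... | yes _ = 1#
      ... | no _ = y

      nonzeroPart-≢0 : ∀ y → nonzeroPart y ≢ 0#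
      nonzeroPart-≢0 y with y ≟ 0#
      ... | yes _ = 1≢0
      ... | no y≢0 = y≢0

      factor : Carrier → Carrier
      factor y with y ≟ 0#
      ... | yes _ = 1#
      ... | no _ = x

      nonzeroPart-x* : ∀ y → nonzeroPart (x * y) ≡ factor y * nonzeroPart y
      nonzeroPart-x* y with y ≟ 0# | (x * y) ≟ 0#
      ... | yes _ | yes _ = sym (*-identityˡ 1#)
      ... | yes refl | no xy≢0 = ⊥-elim (xy≢0 (zeroʳ x))
      ... | no y≢0 | yes xy≡0 = ⊥-elim (*-≢0 x≢0 y≢0 xy≡0)
      ... | no _ | no _ = refl

      ∏-factor : ∏ factor ≡ pow x (q ∸ 1)
      ∏-factor = ∏-const-except x (factor ∘ to) (from 0#) factor-at-0 factor-elsewhere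
        where
        factor-at-0 : factor (to (from 0#)) ≡ 1#
        factor-at-0 with to (from 0#) ≟ 0#
        ... | yes _ = refl
        ... | no ≢0 = ⊥-elim (≢0 (Inverse.strictlyInverseˡ enum 0#))
        factor-elsewhere : ∀ j → j ≢ from 0# → factor (to j) ≡ x
        factor-elsewhere j j≢ with to j ≟ 0#
        ... | yes ≡0 = ⊥-elim (j≢ (trans (sym (Inverse.strictlyInverseʳ enum j)) (cong from ≡0)))
        ... | no _ = refl

      x*[x⁻¹*y] : ∀ y → x * (x ⁻¹ * y) ≡ y
      x*[x⁻¹*y] y = modulo (⁻¹-inverse x x≢0) (solve 3 (λ x x⁻¹ y → x :* (x⁻¹ :* y) := y :+ (x :* x⁻¹ :- # 1) :* y) refl x (x ⁻¹) y)

      x⁻¹*[x*y] : ∀ y → x ⁻¹ * (x * y) ≡ y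
      x⁻¹*[x*y] y = modulo (⁻¹-inverse x x≢0) (solve 3 (λ x x⁻¹ y → x⁻¹ :* (x :* y) := y :+ (x :* x⁻¹ :- # 1) :* y) refl x (x ⁻¹) y)

  -- Translation by 1 permutes the field, so Σ y = Σ (y + 1) = Σ y + q·1.
  ι-q≡0 : ι q ≡ 0#
  ι-q≡0 = sym (+-cancelˡ S 0# (ι q) (begin
    S + 0#                        ≡⟨ +-identityʳ S ⟩
    S                             ≡⟨ Σ-reindex (_+ 1#) (_- 1#) [y-1]+1 [y+1]-1 (λ y → y) ⟩
    Σ (λ y → y + 1#)              ≡⟨ ∑-distrib-+ to (λ _ → 1#) ⟩
    S + Σ (λ _ → 1#)              ≡⟨ cong (S +_) (trans (sum-replicate q) (×ᵤ≈× q 1#)) ⟩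
    S + ι q                    ∎))
    where
    open SumOverField +-commutativeMonoid
    open import Algebra.Properties.CommutativeMonoid.Sum +-commutativeMonoid using (∑-distrib-+; sum-replicate)
    S : Carrier
    S = Σ (λ y → y)
    [y-1]+1 : ∀ y → y - 1# + 1# ≡ y
    [y-1]+1 = solve 1 (λ y → y :- # 1 :+ # 1 := y) refl
    [y+1]-1 : ∀ y → y + 1# - 1# ≡ y
    [y+1]-1 = solve 1 (λ y → y :+ # 1 :- # 1 := y) refl

  ι-periodic : ∀ {n} r t → ι n ≡ 0# → ι (r ℕ.+ t ℕ.* n) ≡ ι r
  ι-periodic {n} r t n≡0 = begin
    ι (r ℕ.+ t ℕ.* n)      ≡⟨ ×-homo-+ 1# r (t ℕ.* n) ⟩
    ι r + ι (t ℕ.* n)      ≡⟨ cong (ι r +_) (×1-homo-* t n) ⟩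
    ι r + ι t * ι n        ≡⟨ cong (λ u → ι r + ι t * u) n≡0 ⟩
    ι r + ι t * 0#         ≡⟨ cong (ι r +_) (zeroʳ _) ⟩
    ι r + 0#               ≡⟨ +-identityʳ _ ⟩
    ι r                    ∎

  ι≡0-mod : ∀ {n r} .{{_ : ℕ.NonZero n}} → q % n ≡ r → ι n ≡ 0# → ι r ≡ 0#
  ι≡0-mod {n} {r} q%n≡r n≡0 = begin
    ι r                               ≡⟨ sym (ι-periodic r (q ℕ./ n) n≡0) ⟩
    ι (r ℕ.+ (q ℕ./ n) ℕ.* n)         ≡⟨ cong (λ m → ι (m ℕ.+ (q ℕ./ n) ℕ.* n)) (sym q%n≡r) ⟩
    ι (q % n ℕ.+ (q ℕ./ n) ℕ.* n)     ≡⟨ cong ι (sym (m≡m%n+[m/n]*n q n)) ⟩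
    ι q                               ≡⟨ ι-q≡0 ⟩
    0#                                ∎

  2≢0 : q % 2 ≡ 1 → 1# + 1# ≢ 0#
  2≢0 q-odd 2≡0 = 1≢0 (ι≡0-mod q-odd 2≡0)

  -- For q = 2 the exponent q ∸ 2 truncates to 0 and pw 0 = 1, hence 3 ≤ q.
  module _ (3≤q : 3 ≤ q) where

    private
      q∸1≡1+[q∸2] : q ∸ 1 ≡ suc (q ∸ 2)
      q∸1≡1+[q∸2] = lemma 3≤q
        where lemma : ∀ {n} → 3 ≤ n → n ∸ 1 ≡ suc (n ∸ 2)
              lemma (s≤s (s≤s (s≤s _))) = refl

      q∸2≡1+[q∸3] : q ∸ 2 ≡ suc (q ∸ 3)
      q∸2≡1+[q∸3] = lemma 3≤q
        where lemma : ∀ {n} → 3 ≤ n → n ∸ 2 ≡ suc (n ∸ 3)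
              lemma (s≤s (s≤s (s≤s _))) = refl

    pw-inverse : ∀ {y z} → y * z ≡ 1# → pw y ≡ z
    pw-inverse {y} {z} yz≡1 = *-cancelʳ y≢0 (trans (*-comm (pw y) y) (begin
      y * pw y           ≡⟨ cong (pow y) (sym q∸1≡1+[q∸2]) ⟩
      pow y (q ∸ 1)      ≡⟨ pow-q∸1≡1 y≢0 ⟩
      1#                 ≡⟨ sym yz≡1 ⟩
      y * z              ≡⟨ *-comm y z ⟩
      z * y              ∎))
      where y≢0 = *≡1⇒≢0 yz≡1

    pw-zero : ∀ {y} → y ≡ 0# → pw y ≡ 0#
    pw-zero refl = trans (cong (pow 0#) q∸2≡1+[q∸3]) (zeroˡ _)

  pw-chain : ∀ {a b₁ b₂ b₃ v₁ v₂ v₃ v₄} →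
             pw a ≡ v₁ → pw (v₁ + b₁) ≡ v₂ → pw (v₂ + b₂) ≡ v₃ → pw (v₃ + b₃) ≡ v₄ →
             pw (pw (pw (pw a + b₁) + b₂) + b₃) ≡ v₄
  pw-chain refl refl refl refl = refl

  -- By Fermat, a square root y of -1 would give 1 = y ^ (q - 1) = (-1) ^ ((q - 1) / 2) = -1.
  -1-nonsquare : q % 4 ≡ 3 → ∀ y → y * y ≢ - 1#
  -1-nonsquare q%4≡3 y y²≡-1 = 2≢0 q-odd (begin
    1# + 1#                          ≡⟨ cong (_+ 1#) (sym (pow-q∸1≡1 y≢0)) ⟩
    pow y (q ∸ 1) + 1#               ≡⟨ cong (λ n → pow y n + 1#) q∸1≡2[1+2t] ⟩
    pow y (2 ℕ.* (1 ℕ.+ 2 ℕ.* t)) + 1#   ≡⟨ cong (_+ 1#) (pow-* y 2 (1 ℕ.+ 2 ℕ.* t)) ⟩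
    pow (y * (y * 1#)) (1 ℕ.+ 2 ℕ.* t) + 1# ≡⟨ cong (λ u → pow u (1 ℕ.+ 2 ℕ.* t) + 1#) (trans (cong (y *_) (*-identityʳ y)) y²≡-1) ⟩
    pow (- 1#) (1 ℕ.+ 2 ℕ.* t) + 1#  ≡⟨ cong (λ u → - 1# * u + 1#) (pow-* (- 1#) 2 t) ⟩
    - 1# * pow (- 1# * (- 1# * 1#)) t + 1# ≡⟨ cong (λ u → - 1# * pow u t + 1#) [-1]²≡1 ⟩
    - 1# * pow 1# t + 1#             ≡⟨ cong (λ u → - 1# * u + 1#) (pow-1# t) ⟩
    - 1# * 1# + 1#                   ≡⟨ solve 0 (:- # 1 :* # 1 :+ # 1 := # 0) refl ⟩
    0#                               ∎)
    where
    open import Data.Nat.Tactic.RingSolver using (solve-∀)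
    t : ℕ
    t = q ℕ./ 4
    q-odd : q % 2 ≡ 1
    q-odd = trans (sym (m∣n⇒o%n%m≡o%m 2 4 q (divides 2 refl))) (cong (_% 2) q%4≡3)
    q∸1≡2[1+2t] : q ∸ 1 ≡ 2 ℕ.* (1 ℕ.+ 2 ℕ.* t)
    q∸1≡2[1+2t] = trans (cong (_∸ 1) (trans (m≡m%n+[m/n]*n q 4) (cong (ℕ._+ t ℕ.* 4) q%4≡3))) (arith t)
      where arith : ∀ t → 2 ℕ.+ t ℕ.* 4 ≡ 2 ℕ.* (1 ℕ.+ 2 ℕ.* t)
            arith = solve-∀
    y≢0 : y ≢ 0#
    y≢0 refl = 1≢0 (modulo y²≡-1 (solve 0 (# 1 := # 0 :+ (# 0 :* # 0 :- :- # 1) :* # 1) refl))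
    [-1]²≡1 : - 1# * (- 1# * 1#) ≡ 1#
    [-1]²≡1 = solve 0 (:- # 1 :* (:- # 1 :* # 1) := # 1) refl

  -- A root y of y² + y + 1 satisfies y³ = 1; with Fermat and 3 ∤ q - 1 this forces y = 1, so 3 = 0.
  no-primitive-cube-root : q % 3 ≡ 2 → ∀ y → y * y + y + 1# ≢ 0#
  no-primitive-cube-root q%3≡2 y h = 1≢0 (+-cancelˡ (1# + 1#) 1# 0# (begin
    (1# + 1#) + 1#    ≡⟨ 3≡0 ⟩
    0#                ≡⟨ sym (ι≡0-mod q%3≡2 3≡0) ⟩
    1# + 1#           ≡⟨ sym (+-identityʳ _) ⟩
    (1# + 1#) + 0#    ∎))
    where
    open import Data.Nat.Tactic.RingSolver using (solve-∀)
    t : ℕ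
    t = q ℕ./ 3
    q∸1≡1+3t : q ∸ 1 ≡ 1 ℕ.+ 3 ℕ.* t
    q∸1≡1+3t = trans (cong (_∸ 1) (trans (m≡m%n+[m/n]*n q 3) (cong (ℕ._+ t ℕ.* 3) q%3≡2))) (arith t)
      where arith : ∀ t → 1 ℕ.+ t ℕ.* 3 ≡ 1 ℕ.+ 3 ℕ.* t
            arith = solve-∀
    y≢0 : y ≢ 0#
    y≢0 refl = 1≢0 (modulo₀ h (solve 0 (# 1 := # 0 :+ (# 0 :* # 0 :+ # 0 :+ # 1) :* # 1) refl))
    y³≡1 : y * (y * (y * 1#)) ≡ 1#
    y³≡1 = modulo₀ h (solve 1 (λ y → y :* (y :* (y :* # 1)) := # 1 :+ (y :* y :+ y :+ # 1) :* (y :- # 1)) refl y)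
    y≡1 : y ≡ 1#
    y≡1 = begin
      y                                ≡⟨ sym (*-identityʳ y) ⟩
      y * 1#                           ≡⟨ cong (y *_) (sym (pow-1# t)) ⟩
      y * pow 1# t                     ≡⟨ cong (λ u → y * pow u t) (sym y³≡1) ⟩
      y * pow (y * (y * (y * 1#))) t   ≡⟨ cong (y *_) (sym (pow-* y 3 t)) ⟩
      pow y (1 ℕ.+ 3 ℕ.* t)            ≡⟨ cong (pow y) (sym q∸1≡1+3t) ⟩
      pow y (q ∸ 1)                    ≡⟨ pow-q∸1≡1 y≢0 ⟩
      1#                               ∎
    3≡0 : ι 3 ≡ 0#
    3≡0 = begin
      (1# + 1#) + 1#        ≡⟨ cong (λ u → u + 1# + 1#) (sym (*-identityˡ 1#)) ⟩
      1# * 1# + 1# + 1#     ≡⟨ cong (λ u → u * u + u + 1#) (sym y≡1) ⟩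
      y * y + y + 1#        ≡⟨ h ⟩
      0#                    ∎

module Preimages (K : FiniteField) where

  open import Data.Nat as ℕ using (ℕ; _≤_; _+_; _∸_; _⊔_; z≤n)
  import Data.Nat.Properties as ℕ
  open import Data.Product using (_×_; _,_; proj₁; proj₂; ∃)
  open import Data.Sum using (inj₁; inj₂)
  open import Data.Empty using (⊥-elim)
  open import Data.List using (List; []; _∷_; length; filter; map; foldr; _++_)
  open import Data.List.Properties using (filter-some; length-++)
  open import Data.List.Relation.Unary.Any using (here; there; any?; satisfied)
  open import Data.List.Relation.Unary.All.Properties using (¬Any⇒All¬)
  import Data.List.Relation.Unary.All as All
  open import Data.List.Membership.Propositional using (_∈_; _∉_; lose)
  open import Data.List.Membership.Propositional.Properties using (∈-filter⁺; ∈-filter⁻; ∈-++⁺ˡ; ∈-++⁺ʳ; ∈-++⁻; ∈-map⁺; ∈-map⁻)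
  open import Data.List.Relation.Unary.Unique.Propositional using (Unique; []; _∷_)
  import Data.List.Relation.Unary.Unique.Propositional.Properties as Unique
  open import Function using (_∘_)
  open import Function.Bundles using (_⇔_; mk⇔; Equivalence)
  open import Relation.Nullary using (Dec; yes; no)
  open import Relation.Nullary.Decidable using (¬?)
  open import Relation.Binary.PropositionalEquality
  open Counting

  open FF K using (Carrier; _≟_; q; elements; preimageCount; InValueSet; IsPermutation; maxCount; numWithCount)
  open FiniteFieldFacts K using (elements-complete; elements-unique; elements-length)
  open import Data.List.Membership.DecPropositional _≟_ using (_∈?_; _∉?_)

  module _ (F : Carrier → Carrier) where

    InValueSet⇔preimageCount≢0 : ∀ β → InValueSet F β ⇔ preimageCount F β ≢ 0
    InValueSet⇔preimageCount≢0 β = mk⇔ to from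
      where
      P? : ∀ x → Dec (F x ≡ β)
      P? x = F x ≟ β
      to : InValueSet F β → preimageCount F β ≢ 0
      to (x , Fx≡β) = ℕ.>⇒≢ (filter-some P? (lose (elements-complete x) Fx≡β))
      from : preimageCount F β ≢ 0 → InValueSet F β
      from count≢0 with any? P? elements
      ... | yes some = satisfied some
      ... | no none = ⊥-elim (count≢0 (count-none P? (¬Any⇒All¬ elements none)))

    preimageCount≡1⇒IsPermutation : (∀ β → preimageCount F β ≡ 1) → IsPermutation F
    preimageCount≡1⇒IsPermutation count≡1 = injective , surjective
      where
      singleton : ∀ {xs : List Carrier} {x y} → length xs ≡ 1 → x ∈ xs → y ∈ xs → x ≡ y
      singleton {_ ∷ []} _ (here refl) (here refl) = refl
      injective : ∀ {x y} → F x ≡ F y → x ≡ y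
      injective {x} {y} Fx≡Fy =
        singleton (count≡1 (F y)) (∈-filter⁺ (λ z → F z ≟ F y) (elements-complete x) Fx≡Fy)
                                  (∈-filter⁺ (λ z → F z ≟ F y) (elements-complete y) refl)
      surjective : ∀ β → ∃ λ x → ∀ {z} → z ≡ x → F z ≡ β
      surjective β with Equivalence.from (InValueSet⇔preimageCount≢0 β) (λ c≡0 → ℕ.1+n≢0 (trans (sym (count≡1 β)) c≡0))
      ... | x , Fx≡β = x , λ { refl → Fx≡β }

    maxCount≡ : ∀ {m} → (∀ β → preimageCount F β ≤ m) → ∀ β₀ → preimageCount F β₀ ≡ m → maxCount F ≡ m
    maxCount≡ {m} ≤m β₀ count≡m = ℕ.≤-antisym (upper elements) (lower elements (elements-complete β₀))
      where
      maximum : List Carrier → ℕ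
      maximum xs = foldr _⊔_ 0 (map (preimageCount F) xs)
      upper : ∀ xs → maximum xs ≤ m
      upper [] = z≤n
      upper (x ∷ xs) = ℕ.⊔-lub (≤m x) (upper xs)
      lower : ∀ xs → β₀ ∈ xs → m ≤ maximum xs
      lower (x ∷ xs) (here refl) = subst (_≤ _) count≡m (ℕ.m≤m⊔n _ _)
      lower (x ∷ xs) (there β₀∈xs) = ℕ.≤-trans (lower xs β₀∈xs) (ℕ.m≤n⊔m _ _)

    numWithCount≡length : ∀ {k ys} → Unique ys → (∀ β → preimageCount F β ≡ k ⇔ β ∈ ys) → numWithCount F k ≡ length ys
    numWithCount≡length {k} ys! count≡k⇔∈ =
      count-≡-length (λ β → preimageCount F β ℕ.≟ k) elements-unique ys!
        (mk⇔ (λ (_ , c≡k) → Equivalence.to (count≡k⇔∈ _) c≡k) (λ β∈ys → elements-complete _ , Equivalence.from (count≡k⇔∈ _) β∈ys))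

    numWithCount≡q∸length : ∀ {k ys} → Unique ys → (∀ β → preimageCount F β ≡ k ⇔ β ∉ ys) → numWithCount F k ≡ q ∸ length ys
    numWithCount≡q∸length {k} {ys} ys! count≡k⇔∉ = begin
      numWithCount F k                                  ≡⟨ sym (ℕ.m+n∸n≡m _ (length ys)) ⟩
      numWithCount F k + length ys ∸ length ys          ≡⟨ cong (λ n → numWithCount F k + n ∸ length ys) (sym complement) ⟩
      numWithCount F k + count (¬? ∘ P?) elements ∸ length ys ≡⟨ cong (_∸ length ys) (count-+-count-∁ P? elements) ⟩
      length elements ∸ length ys                       ≡⟨ cong (_∸ length ys) elements-length ⟩
      q ∸ length ys                                     ∎
      where
      open ≡-Reasoning
      P? : ∀ β → Dec (preimageCount F β ≡ k)
      P? β = preimageCount F β ℕ.≟ k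
      complement : count (¬? ∘ P?) elements ≡ length ys
      complement = count-≡-length (¬? ∘ P?) elements-unique ys!
        (mk⇔ (λ (_ , c≢k) → decidable-stable (_ ∈? ys) (c≢k ∘ Equivalence.from (count≡k⇔∉ _)))
             (λ β∈ys → elements-complete _ , (λ c≡k → Equivalence.to (count≡k⇔∉ _) c≡k β∈ys)))
        where open import Relation.Nullary.Decidable using (decidable-stable)

  module AgreesWithBijectionOutside
    (F L L⁻¹ : Carrier → Carrier) (L∘L⁻¹ : ∀ y → L (L⁻¹ y) ≡ y) (L⁻¹∘L : ∀ x → L⁻¹ (L x) ≡ x)
    (S : List Carrier) (S! : Unique S) (F≡L : ∀ x → x ∉ S → F x ≡ L x) where

    L⁻¹∈S⇔∈L[S] : ∀ β → L⁻¹ β ∈ S ⇔ β ∈ map L S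
    L⁻¹∈S⇔∈L[S] β = mk⇔ (λ L⁻¹β∈S → subst (_∈ map L S) (L∘L⁻¹ β) (∈-map⁺ L L⁻¹β∈S))
                        (λ β∈L[S] → let (s , s∈S , β≡Ls) = ∈-map⁻ L β∈L[S]
                                    in subst (_∈ S) (trans (sym (L⁻¹∘L s)) (cong L⁻¹ (sym β≡Ls))) s∈S)

    -- The preimages of β are its preimages in S, plus L⁻¹ β when that lies outside S.
    preimageCount-formula : ∀ β → preimageCount F β ≡ count (_≟ β) (map F S) + 𝟙 (β ∉? map L S)
    preimageCount-formula β = begin
      count P? elements                                           ≡⟨ count-≡-length P? elements-unique preimages! members ⟩
      length (filter P? S ++ filter (_∉? S) (L⁻¹ β ∷ []))         ≡⟨ length-++ (filter P? S) ⟩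
      count P? S + count (_∉? S) (L⁻¹ β ∷ [])                     ≡⟨ cong₂ _+_ (count-map (_≟ β) F S) (count-∷ (_∉? S) (L⁻¹ β) []) ⟩
      count (_≟ β) (map F S) + (𝟙 (L⁻¹ β ∉? S) + 0)             ≡⟨ cong (count (_≟ β) (map F S) +_) (trans (ℕ.+-identityʳ _) L⁻¹∉S-𝟙) ⟩
      count (_≟ β) (map F S) + 𝟙 (β ∉? map L S)                  ∎
      where
      open ≡-Reasoning
      P? : ∀ x → Dec (F x ≡ β)
      P? x = F x ≟ β
      L⁻¹∉S-𝟙 : 𝟙 (L⁻¹ β ∉? S) ≡ 𝟙 (β ∉? map L S)
      L⁻¹∉S-𝟙 = 𝟙-⇔ (L⁻¹ β ∉? S) (β ∉? map L S)
                  (mk⇔ (λ ∉S ∈L[S] → ∉S (Equivalence.from (L⁻¹∈S⇔∈L[S] β) ∈L[S]))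
                       (λ ∉L[S] ∈S → ∉L[S] (Equivalence.to (L⁻¹∈S⇔∈L[S] β) ∈S)))
      preimages! : Unique (filter P? S ++ filter (_∉? S) (L⁻¹ β ∷ []))
      preimages! = Unique.++⁺ (Unique.filter⁺ P? S!) (Unique.filter⁺ (_∉? S) (All.[] ∷ []))
                     (λ (x∈₁ , x∈₂) → proj₂ (∈-filter⁻ (_∉? S) x∈₂) (proj₁ (∈-filter⁻ P? x∈₁)))
      members : ∀ {x} → (x ∈ elements × F x ≡ β) ⇔ x ∈ filter P? S ++ filter (_∉? S) (L⁻¹ β ∷ [])
      members {x} = mk⇔ to from
        where
        to : x ∈ elements × F x ≡ β → x ∈ filter P? S ++ filter (_∉? S) (L⁻¹ β ∷ [])
        to (_ , Fx≡β) with x ∈? S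
        ... | yes x∈S = ∈-++⁺ˡ (∈-filter⁺ P? x∈S Fx≡β)
        ... | no x∉S = ∈-++⁺ʳ (filter P? S)
                         (∈-filter⁺ (_∉? S) (here (trans (sym (L⁻¹∘L x)) (cong L⁻¹ (trans (sym (F≡L x x∉S)) Fx≡β)))) x∉S)
        from : x ∈ filter P? S ++ filter (_∉? S) (L⁻¹ β ∷ []) → x ∈ elements × F x ≡ β
        from x∈ with ∈-++⁻ (filter P? S) x∈
        ... | inj₁ x∈₁ = elements-complete x , proj₂ (∈-filter⁻ P? {xs = S} x∈₁)
        ... | inj₂ x∈₂ with ∈-filter⁻ (_∉? S) x∈₂
        ... | here refl , x∉S = elements-complete x , trans (F≡L x x∉S) (L∘L⁻¹ β)

  module AgreesWithBijectionOffThreePoints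
    (F L L⁻¹ : Carrier → Carrier) (L∘L⁻¹ : ∀ y → L (L⁻¹ y) ≡ y) (L⁻¹∘L : ∀ x → L⁻¹ (L x) ≡ x)
    (s₁ s₂ s₃ : Carrier) (s₁≢s₂ : s₁ ≢ s₂) (s₁≢s₃ : s₁ ≢ s₃) (s₂≢s₃ : s₂ ≢ s₃)
    (F≡L : ∀ x → x ≢ s₁ → x ≢ s₂ → x ≢ s₃ → F x ≡ L x)
    {v₁ v₂ v₃ w₁ w₂ w₃ : Carrier} (F[s₁] : F s₁ ≡ v₁) (F[s₂] : F s₂ ≡ v₂) (F[s₃] : F s₃ ≡ v₃)
    (L[s₁] : L s₁ ≡ w₁) (L[s₂] : L s₂ ≡ w₂) (L[s₃] : L s₃ ≡ w₃) where

    S : List Carrier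
    S = s₁ ∷ s₂ ∷ s₃ ∷ []

    open AgreesWithBijectionOutside F L L⁻¹ L∘L⁻¹ L⁻¹∘L S
      ((s₁≢s₂ All.∷ s₁≢s₃ All.∷ All.[]) ∷ (s₂≢s₃ All.∷ All.[]) ∷ All.[] ∷ [])
      (λ x x∉S → F≡L x (x∉S ∘ here) (x∉S ∘ there ∘ here) (x∉S ∘ there ∘ there ∘ here))
      public

    F[S] : map F S ≡ v₁ ∷ v₂ ∷ v₃ ∷ []
    F[S] = cong₂ _∷_ F[s₁] (cong₂ _∷_ F[s₂] (cong (_∷ []) F[s₃]))

    L[S] : map L S ≡ w₁ ∷ w₂ ∷ w₃ ∷ []
    L[S] = cong₂ _∷_ L[s₁] (cong₂ _∷_ L[s₂] (cong (_∷ []) L[s₃]))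

    preimageCount-by : ∀ β {i₁ i₂ i₃ j} →
                       𝟙 (v₁ ≟ β) ≡ i₁ → 𝟙 (v₂ ≟ β) ≡ i₂ → 𝟙 (v₃ ≟ β) ≡ i₃ → 𝟙 (β ∉? w₁ ∷ w₂ ∷ w₃ ∷ []) ≡ j →
                       preimageCount F β ≡ i₁ + i₂ + i₃ + j
    preimageCount-by β refl refl refl refl = begin
      preimageCount F β                                                     ≡⟨ preimageCount-formula β ⟩
      count (_≟ β) (map F S) + 𝟙 (β ∉? map L S)                             ≡⟨ cong₂ (λ vs ws → count (_≟ β) vs + 𝟙 (β ∉? ws)) F[S] L[S] ⟩
      count (_≟ β) (v₁ ∷ v₂ ∷ v₃ ∷ []) + 𝟙 (β ∉? w₁ ∷ w₂ ∷ w₃ ∷ [])         ≡⟨ cong (_+ 𝟙 (β ∉? w₁ ∷ w₂ ∷ w₃ ∷ [])) (count-≟₃ _≟_ β) ⟩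
      𝟙 (v₁ ≟ β) + 𝟙 (v₂ ≟ β) + 𝟙 (v₃ ≟ β) + 𝟙 (β ∉? w₁ ∷ w₂ ∷ w₃ ∷ [])   ∎
      where open ≡-Reasoning

module SharedEvaluations (K : FiniteField) where

  open import Data.Nat using (_≤_)
  open import Relation.Binary.PropositionalEquality
  open FF K
  open FiniteFieldFacts K

  module Evaluation (3≤q : 3 ≤ q) (c : Carrier) (c≢0 : c ≢ 0#) (d : Carrier) (d+1≢0 : d + 1# ≢ 0#) where

    private
      c⁻¹ : Carrier
      c⁻¹ = c ⁻¹
      [d+1]⁻¹ : Carrier
      [d+1]⁻¹ = (d + 1#) ⁻¹
      hc : c * c⁻¹ ≡ 1#
      hc = ⁻¹-inverse c c≢0
      he : (d + 1#) * [d+1]⁻¹ ≡ 1#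
      he = ⁻¹-inverse (d + 1#) d+1≢0

    chain-from-0 : ∀ {a} → a ≡ 0# → pw (pw (pw (pw a + c) + d / c) - c / (d + 1#)) ≡ 0#
    chain-from-0 a≡0 = pw-chain (pw-zero 3≤q a≡0) (pw-inverse 3≤q step₂) (pw-inverse 3≤q step₃) (pw-zero 3≤q (-‿inverseʳ (c / (d + 1#))))
      where
      step₂ : (0# + c) * c⁻¹ ≡ 1#
      step₂ = modulo hc (solve 2 (λ c⁻¹ c → (# 0 :+ c) :* c⁻¹ := # 1 :+ (c :* c⁻¹ :- # 1) :* # 1) refl c⁻¹ c)
      step₃ : (c⁻¹ + d / c) * (c / (d + 1#)) ≡ 1#
      step₃ = modulo hc (modulo he (solve 4 (λ [d+1]⁻¹ c⁻¹ c d → (c⁻¹ :+ d :* c⁻¹) :* (c :* [d+1]⁻¹) := # 1 :+ (c :* c⁻¹ :- # 1) :* ([d+1]⁻¹ :+ [d+1]⁻¹ :* d) :+ ((d :+ # 1) :* [d+1]⁻¹ :- # 1) :* # 1) refl [d+1]⁻¹ c⁻¹ c d))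

    pw[0-c/[d+1]] : pw (0# - c / (d + 1#)) ≡ - ((d + 1#) / c)
    pw[0-c/[d+1]] = pw-inverse 3≤q (modulo hc (modulo he (solve 4 (λ [d+1]⁻¹ c⁻¹ c d → (# 0 :- c :* [d+1]⁻¹) :* :- ((d :+ # 1) :* c⁻¹) := # 1 :+ (c :* c⁻¹ :- # 1) :* ([d+1]⁻¹ :+ [d+1]⁻¹ :* d) :+ ((d :+ # 1) :* [d+1]⁻¹ :- # 1) :* # 1) refl [d+1]⁻¹ c⁻¹ c d)))

    F₁[0]≡0 : F₁ c d 0# ≡ 0#
    F₁[0]≡0 = trans (cong (_+ 0#) (chain-from-0 (trans (cong (_* [d+1]⁻¹) -0#≈0#) (zeroˡ [d+1]⁻¹)))) (+-identityʳ 0#)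

    F₃[0]≡0 : F₃ c d 0# ≡ 0#
    F₃[0]≡0 = trans (cong (_+ 0#) (chain-from-0 (zeroˡ _))) (+-identityʳ 0#)

    module F₁-Points (d≢0 : d ≢ 0#) where

      0≢[d+1]/c : 0# ≢ (d + 1#) / c
      0≢[d+1]/c 0≡ = d+1≢0 (modulo₀ (sym 0≡) (modulo hc (solve 3 (λ c⁻¹ c d → d :+ # 1 := # 0 :+ (d :+ # 1) :* c⁻¹ :* c :+ (c :* c⁻¹ :- # 1) :* (:- # 1 :- d)) refl c⁻¹ c d)))

      0≢d/c : 0# ≢ d / c
      0≢d/c 0≡ = d≢0 (modulo₀ (sym 0≡) (modulo hc (solve 3 (λ c⁻¹ c d → d := # 0 :+ d :* c⁻¹ :* c :+ (c :* c⁻¹ :- # 1) :* :- d) refl c⁻¹ c d)))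

      [d+1]/c≢d/c : (d + 1#) / c ≢ d / c
      [d+1]/c≢d/c eq = 1≢0 (modulo eq (modulo hc (solve 3 (λ c⁻¹ c d → # 1 := # 0 :+ ((d :+ # 1) :* c⁻¹ :- d :* c⁻¹) :* c :+ (c :* c⁻¹ :- # 1) :* :- # 1) refl c⁻¹ c d)))

      F₁-step₁ : ∀ {x} → x ≢ 0# → pw ((- x) / (d + 1#)) ≡ - ((d + 1#) / x)
      F₁-step₁ {x} x≢0 = pw-inverse 3≤q (modulo he (modulo (⁻¹-inverse x x≢0) (solve 4 (λ x⁻¹ [d+1]⁻¹ x d → :- x :* [d+1]⁻¹ :* :- ((d :+ # 1) :* x⁻¹) := # 1 :+ ((d :+ # 1) :* [d+1]⁻¹ :- # 1) :* (x⁻¹ :* x) :+ (x :* x⁻¹ :- # 1) :* # 1) refl (x ⁻¹) [d+1]⁻¹ x d)))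

      F₁-step₂ : ∀ {x} → x ≢ 0# → x ≢ (d + 1#) / c → pw (- ((d + 1#) / x) + c) ≡ x / (c * x - (d + 1#))
      F₁-step₂ {x} x≢0 x≢[d+1]/c = pw-inverse 3≤q (modulo (⁻¹-inverse x x≢0) (modulo (⁻¹-inverse u u≢0) (solve 5 (λ x⁻¹ u⁻¹ x c d → (:- ((d :+ # 1) :* x⁻¹) :+ c) :* (x :* u⁻¹) := # 1 :+ (x :* x⁻¹ :- # 1) :* (:- u⁻¹ :- u⁻¹ :* d) :+ ((c :* x :- (d :+ # 1)) :* u⁻¹ :- # 1) :* # 1) refl (x ⁻¹) (u ⁻¹) x c d)))
        where
        u : Carrier
        u = c * x - (d + 1#)
        u≢0 : u ≢ 0#
        u≢0 u≡0 = x≢[d+1]/c (modulo₀ u≡0 (modulo hc (solve 4 (λ c⁻¹ x c d → x := (d :+ # 1) :* c⁻¹ :+ (c :* x :- (d :+ # 1)) :* c⁻¹ :+ (c :* c⁻¹ :- # 1) :* :- x) refl c⁻¹ x c d)))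

      F₁[[d+1]/c]-step₁ : pw ((- ((d + 1#) / c)) / (d + 1#)) ≡ - c
      F₁[[d+1]/c]-step₁ = pw-inverse 3≤q (modulo hc (modulo he (solve 4 (λ [d+1]⁻¹ c⁻¹ c d → :- ((d :+ # 1) :* c⁻¹) :* [d+1]⁻¹ :* :- c := # 1 :+ (c :* c⁻¹ :- # 1) :* ([d+1]⁻¹ :+ [d+1]⁻¹ :* d) :+ ((d :+ # 1) :* [d+1]⁻¹ :- # 1) :* # 1) refl [d+1]⁻¹ c⁻¹ c d)))

module PartI (K : FiniteField) where

  open import Data.Nat as ℕ using (_≤_)
  open import Data.Product using (_×_; _,_)
  open import Data.List using ([]; _∷_; map)
  open import Data.List.Relation.Unary.All using ([]; _∷_)
  open import Data.List.Relation.Unary.Unique.Propositional using (Unique; []; _∷_)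
  open import Data.List.Membership.DecPropositional (FiniteField._≟_ K) using (_∉?_)
  open import Relation.Binary.PropositionalEquality
  open FF K
  open FiniteFieldFacts K
  open SharedEvaluations K
  open Preimages K
  open Counting

  module _ (3≤q : 3 ≤ q) (c : Carrier) (c≢0 : c ≢ 0#) (d : Carrier) (h : d * d + d + 1# ≡ 0#) where

    private
      c⁻¹ : Carrier
      c⁻¹ = c ⁻¹
      hc : c * c⁻¹ ≡ 1#
      hc = ⁻¹-inverse c c≢0

    d+1≢0 : d + 1# ≢ 0#
    d+1≢0 d+1≡0 = 1≢0 (modulo₀ d+1≡0 (modulo₀ h (solve 1 (λ d → # 1 := # 0 :+ (d :+ # 1) :* :- d :+ (d :* d :+ d :+ # 1) :* # 1) refl d)))

    d≢0 : d ≢ 0#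
    d≢0 d≡0 = 1≢0 (modulo₀ d≡0 (modulo₀ h (solve 1 (λ d → # 1 := # 0 :+ d :* (:- # 1 :- d) :+ (d :* d :+ d :+ # 1) :* # 1) refl d)))

    open Evaluation 3≤q c c≢0 d d+1≢0
    open F₁-Points d≢0

    private
      [d+1]⁻¹ : Carrier
      [d+1]⁻¹ = (d + 1#) ⁻¹
      he : (d + 1#) * [d+1]⁻¹ ≡ 1#
      he = ⁻¹-inverse (d + 1#) d+1≢0

    L : Carrier → Carrier
    L x = - (d * x) - c⁻¹

    L⁻¹ : Carrier → Carrier
    L⁻¹ y = (y + c⁻¹) * (d + 1#)

    F₁≡L : ∀ x → x ≢ 0# → x ≢ (d + 1#) / c → x ≢ d / c → F₁ c d x ≡ L x
    F₁≡L x x≢0 x≢[d+1]/c x≢d/c =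
      trans (cong (_+ x) (pw-chain (F₁-step₁ x≢0) (F₁-step₂ x≢0 x≢[d+1]/c)
                                   (pw-inverse 3≤q step₃) (pw-inverse 3≤q step₄)))
            (modulo hc (solve 4 (λ c⁻¹ x c d → :- (((d :+ # 1) :* c :* x :+ # 1) :* c⁻¹) :+ x := :- (d :* x) :- c⁻¹ :+ (c :* c⁻¹ :- # 1) :* (:- x :- x :* d)) refl c⁻¹ x c d))
      where
      u : Carrier
      u = c * x - (d + 1#)
      v : Carrier
      v = (d + 1#) * c * x + 1#
      u≢0 : u ≢ 0#
      u≢0 u≡0 = x≢[d+1]/c (modulo₀ u≡0 (modulo hc (solve 4 (λ c⁻¹ x c d → x := (d :+ # 1) :* c⁻¹ :+ (c :* x :- (d :+ # 1)) :* c⁻¹ :+ (c :* c⁻¹ :- # 1) :* :- x) refl c⁻¹ x c d)))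
      v≢0 : v ≢ 0#
      v≢0 v≡0 = x≢d/c (modulo₀ v≡0 (modulo hc (modulo₀ h (solve 5 (λ [d+1]⁻¹ c⁻¹ x c d → x := d :* c⁻¹ :+ ((d :+ # 1) :* c :* x :+ # 1) :* :- (c⁻¹ :* d) :+ (c :* c⁻¹ :- # 1) :* (x :* d :+ x :* d :* d) :+ (d :* d :+ d :+ # 1) :* x) refl [d+1]⁻¹ c⁻¹ x c d))))
      step₃ : (x / u + d / c) * (c * u / v) ≡ 1#
      step₃ = modulo (⁻¹-inverse u u≢0) (modulo hc (modulo (⁻¹-inverse v v≢0) (modulo₀ h (solve 6 (λ u⁻¹ v⁻¹ c⁻¹ x c d → (x :* u⁻¹ :+ d :* c⁻¹) :* (c :* (c :* x :- (d :+ # 1)) :* v⁻¹) := # 1 :+ ((c :* x :- (d :+ # 1)) :* u⁻¹ :- # 1) :* (v⁻¹ :* x :* c) :+ (c :* c⁻¹ :- # 1) :* (:- (v⁻¹ :* d) :- v⁻¹ :* d :* d :+ v⁻¹ :* x :* c :* d) :+ (((d :+ # 1) :* c :* x :+ # 1) :* v⁻¹ :- # 1) :* # 1 :+ (d :* d :+ d :+ # 1) :* :- v⁻¹) refl (u ⁻¹) (v ⁻¹) c⁻¹ x c d))))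
      step₄ : (c * u / v - c / (d + 1#)) * (- (v / c)) ≡ 1#
      step₄ = modulo (⁻¹-inverse v v≢0) (modulo hc (modulo he (modulo₀ h (solve 6 (λ v⁻¹ [d+1]⁻¹ c⁻¹ x c d → (c :* (c :* x :- (d :+ # 1)) :* v⁻¹ :- c :* [d+1]⁻¹) :* :- (((d :+ # 1) :* c :* x :+ # 1) :* c⁻¹) := # 1 :+ (((d :+ # 1) :* c :* x :+ # 1) :* v⁻¹ :- # 1) :* (c⁻¹ :* c :+ c⁻¹ :* c :* d :- c⁻¹ :* x :* c :* c) :+ (c :* c⁻¹ :- # 1) :* (# 1 :+ d :- x :* c :+ [d+1]⁻¹ :+ [d+1]⁻¹ :* x :* c :+ [d+1]⁻¹ :* x :* c :* d) :+ ((d :+ # 1) :* [d+1]⁻¹ :- # 1) :* (:- d :+ x :* c) :+ (d :* d :+ d :+ # 1) :* [d+1]⁻¹) refl (v ⁻¹) [d+1]⁻¹ c⁻¹ x c d))))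

    F₁-at-[d+1]/c : F₁ c d ((d + 1#) / c) ≡ - c⁻¹ + (d + 1#) / c
    F₁-at-[d+1]/c = cong (_+ (d + 1#) / c)
      (pw-chain F₁[[d+1]/c]-step₁ (pw-zero 3≤q (-‿inverseˡ c)) (pw-inverse 3≤q step₃) (pw-inverse 3≤q step₄))
      where
      step₃ : (0# + d / c) * (- (c * (d + 1#))) ≡ 1#
      step₃ = modulo hc (modulo₀ h (solve 3 (λ c⁻¹ c d → (# 0 :+ d :* c⁻¹) :* :- (c :* (d :+ # 1)) := # 1 :+ (c :* c⁻¹ :- # 1) :* (:- d :- d :* d) :+ (d :* d :+ d :+ # 1) :* :- # 1) refl c⁻¹ c d))
      step₄ : (- (c * (d + 1#)) - c / (d + 1#)) * (- c⁻¹) ≡ 1#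
      step₄ = modulo hc (modulo he (modulo₀ h (solve 4 (λ [d+1]⁻¹ c⁻¹ c d → (:- (c :* (d :+ # 1)) :- c :* [d+1]⁻¹) :* :- c⁻¹ := # 1 :+ (c :* c⁻¹ :- # 1) :* (# 1 :+ d :+ [d+1]⁻¹) :+ ((d :+ # 1) :* [d+1]⁻¹ :- # 1) :* :- d :+ (d :* d :+ d :+ # 1) :* [d+1]⁻¹) refl [d+1]⁻¹ c⁻¹ c d)))

    F₁-at-d/c : F₁ c d (d / c) ≡ - ((d + 1#) / c) + d / c
    F₁-at-d/c = cong (_+ d / c) (pw-chain (pw-inverse 3≤q step₁) (pw-inverse 3≤q step₂) (pw-zero 3≤q step₃) pw[0-c/[d+1]])
      where
      step₁ : ((- (d / c)) / (d + 1#)) * (c * ((d + 1#) * (d + 1#))) ≡ 1#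
      step₁ = modulo hc (modulo he (modulo₀ h (solve 4 (λ [d+1]⁻¹ c⁻¹ c d → :- (d :* c⁻¹) :* [d+1]⁻¹ :* (c :* ((d :+ # 1) :* (d :+ # 1))) := # 1 :+ (c :* c⁻¹ :- # 1) :* (:- ([d+1]⁻¹ :* d) :- # 2 :* [d+1]⁻¹ :* d :* d :- [d+1]⁻¹ :* d :* d :* d) :+ ((d :+ # 1) :* [d+1]⁻¹ :- # 1) :* (:- d :- d :* d) :+ (d :* d :+ d :+ # 1) :* :- # 1) refl [d+1]⁻¹ c⁻¹ c d)))
      step₂ : (c * ((d + 1#) * (d + 1#)) + c) * (c⁻¹ * [d+1]⁻¹) ≡ 1#
      step₂ = modulo hc (modulo he (modulo₀ h (solve 4 (λ [d+1]⁻¹ c⁻¹ c d → (c :* ((d :+ # 1) :* (d :+ # 1)) :+ c) :* (c⁻¹ :* [d+1]⁻¹) := # 1 :+ (c :* c⁻¹ :- # 1) :* (# 2 :* [d+1]⁻¹ :+ # 2 :* [d+1]⁻¹ :* d :+ [d+1]⁻¹ :* d :* d) :+ ((d :+ # 1) :* [d+1]⁻¹ :- # 1) :* # 1 :+ (d :* d :+ d :+ # 1) :* [d+1]⁻¹) refl [d+1]⁻¹ c⁻¹ c d)))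
      step₃ : c⁻¹ * [d+1]⁻¹ + d / c ≡ 0#
      step₃ = modulo he (modulo₀ h (solve 3 (λ [d+1]⁻¹ c⁻¹ d → c⁻¹ :* [d+1]⁻¹ :+ d :* c⁻¹ := # 0 :+ ((d :+ # 1) :* [d+1]⁻¹ :- # 1) :* :- (c⁻¹ :* d) :+ (d :* d :+ d :+ # 1) :* ([d+1]⁻¹ :* c⁻¹)) refl [d+1]⁻¹ c⁻¹ d))

    F₁[[d+1]/c]≡d/c : F₁ c d ((d + 1#) / c) ≡ d / c
    F₁[[d+1]/c]≡d/c = trans F₁-at-[d+1]/c (solve 2 (λ c⁻¹ d → :- c⁻¹ :+ (d :+ # 1) :* c⁻¹ := d :* c⁻¹) refl c⁻¹ d)

    F₁[d/c]≡-c⁻¹ : F₁ c d (d / c) ≡ - c⁻¹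
    F₁[d/c]≡-c⁻¹ = trans F₁-at-d/c (solve 2 (λ c⁻¹ d → :- ((d :+ # 1) :* c⁻¹) :+ d :* c⁻¹ := :- c⁻¹) refl c⁻¹ d)

    L∘L⁻¹ : ∀ y → L (L⁻¹ y) ≡ y
    L∘L⁻¹ y = modulo₀ h (solve 3 (λ c⁻¹ y d → :- (d :* ((y :+ c⁻¹) :* (d :+ # 1))) :- c⁻¹ := y :+ (d :* d :+ d :+ # 1) :* (:- y :- c⁻¹)) refl c⁻¹ y d)

    L⁻¹∘L : ∀ x → L⁻¹ (L x) ≡ x
    L⁻¹∘L x = modulo₀ h (solve 3 (λ c⁻¹ x d → (:- (d :* x) :- c⁻¹ :+ c⁻¹) :* (d :+ # 1) := x :+ (d :* d :+ d :+ # 1) :* :- x) refl c⁻¹ x d)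

    -- F₁ and L map the exceptional points onto the same three values 0, d/c, -1/c, in a different order.
    isPermutation : IsPermutation (F₁ c d)
    isPermutation = preimageCount≡1⇒IsPermutation (F₁ c d) λ β → begin
      preimageCount (F₁ c d) β                                     ≡⟨ preimageCount-formula β ⟩
      count (_≟ β) (map (F₁ c d) S) ℕ.+ 𝟙 (β ∉? map L S)           ≡⟨ cong₂ (λ vs ws → count (_≟ β) vs ℕ.+ 𝟙 (β ∉? ws)) F[S] L[S] ⟩
      count (_≟ β) (0# ∷ d / c ∷ - c⁻¹ ∷ []) ℕ.+ 𝟙 (β ∉? - c⁻¹ ∷ 0# ∷ d / c ∷ []) ≡⟨ count-≟+𝟙∉≡1 _≟_ values! ∈-rotate β ⟩
      1                                                            ∎
      where
      open ≡-Reasoning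
      open AgreesWithBijectionOffThreePoints (F₁ c d) L L⁻¹ L∘L⁻¹ L⁻¹∘L 0# ((d + 1#) / c) (d / c)
        0≢[d+1]/c 0≢d/c [d+1]/c≢d/c F₁≡L F₁[0]≡0 F₁[[d+1]/c]≡d/c F₁[d/c]≡-c⁻¹
        (solve 2 (λ c⁻¹ d → :- (d :* # 0) :- c⁻¹ := :- c⁻¹) refl c⁻¹ d) (modulo₀ h (solve 3 (λ c⁻¹ c d → :- (d :* ((d :+ # 1) :* c⁻¹)) :- c⁻¹ := # 0 :+ (d :* d :+ d :+ # 1) :* :- c⁻¹) refl c⁻¹ c d)) (modulo₀ h (solve 3 (λ c⁻¹ c d → :- (d :* (d :* c⁻¹)) :- c⁻¹ := d :* c⁻¹ :+ (d :* d :+ d :+ # 1) :* :- c⁻¹) refl c⁻¹ c d))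
      values! : Unique (0# ∷ d / c ∷ - c⁻¹ ∷ [])
      values! = (0≢d/c ∷ 0≢-c⁻¹ ∷ []) ∷ (d/c≢-c⁻¹ ∷ []) ∷ [] ∷ []
        where
        0≢-c⁻¹ : 0# ≢ - c⁻¹
        0≢-c⁻¹ 0≡ = 1≢0 (modulo₀ (sym 0≡) (modulo hc (solve 2 (λ c⁻¹ c → # 1 := # 0 :+ :- c⁻¹ :* :- c :+ (c :* c⁻¹ :- # 1) :* :- # 1) refl c⁻¹ c)))
        d/c≢-c⁻¹ : d / c ≢ - c⁻¹
        d/c≢-c⁻¹ eq = d+1≢0 (modulo eq (modulo hc (solve 3 (λ c⁻¹ c d → d :+ # 1 := # 0 :+ (d :* c⁻¹ :- :- c⁻¹) :* c :+ (c :* c⁻¹ :- # 1) :* (:- # 1 :- d)) refl c⁻¹ c d)))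

    partI : let f = λ x → F₁ c d x - x
                g = λ x → - ((d + 1#) * x) + (d * d + d) / c
            in IsPermutation (F₁ c d)
               × (∀ x → x ≢ 0# → x ≢ (d + 1#) / c → x ≢ d / c → f x ≡ g x)
               × f 0# ≡ 0# × g (d / c) ≡ 0#
               × f ((d + 1#) / c) ≡ g 0#
               × f (d / c) ≡ g ((d + 1#) / c)
    partI = isPermutation
          , (λ x x≢0 x≢[d+1]/c x≢d/c → trans (cong (_- x) (F₁≡L x x≢0 x≢[d+1]/c x≢d/c)) (modulo₀ h (solve 4 (λ c⁻¹ x c d → :- (d :* x) :- c⁻¹ :- x := :- ((d :+ # 1) :* x) :+ (d :* d :+ d) :* c⁻¹ :+ (d :* d :+ d :+ # 1) :* :- c⁻¹) refl c⁻¹ x c d)))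
          , trans (cong (_- 0#) F₁[0]≡0) (-‿inverseʳ 0#)
          , (solve 2 (λ c⁻¹ d → :- ((d :+ # 1) :* (d :* c⁻¹)) :+ (d :* d :+ d) :* c⁻¹ := # 0) refl c⁻¹ d)
          , trans (cong (_- (d + 1#) / c) F₁-at-[d+1]/c) (modulo₀ h (solve 2 (λ c⁻¹ d → :- c⁻¹ :+ (d :+ # 1) :* c⁻¹ :- (d :+ # 1) :* c⁻¹ := :- ((d :+ # 1) :* # 0) :+ (d :* d :+ d) :* c⁻¹ :+ (d :* d :+ d :+ # 1) :* :- c⁻¹) refl c⁻¹ d))
          , trans (cong (_- d / c) F₁-at-d/c) (solve 2 (λ c⁻¹ d → :- ((d :+ # 1) :* c⁻¹) :+ d :* c⁻¹ :- d :* c⁻¹ := :- ((d :+ # 1) :* ((d :+ # 1) :* c⁻¹)) :+ (d :* d :+ d) :* c⁻¹) refl c⁻¹ d)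

module PartII (K : FiniteField) where

  open import Data.Nat as ℕ using (_≤_; _%_; s≤s; z≤n)
  import Data.Nat.Properties as ℕₚ
  open import Data.Product using (_×_; _,_)
  open import Data.Sum using (inj₁; inj₂)
  open import Data.Empty using (⊥-elim)
  open import Data.List using ([]; _∷_)
  open import Data.List.Relation.Unary.Any using (here; there)
  open import Function.Bundles using (_⇔_; mk⇔; Equivalence)
  open import Relation.Nullary using (yes; no)
  open import Relation.Binary.PropositionalEquality
  open FF K
  open FiniteFieldFacts K
  open SharedEvaluations K
  open Preimages K
  open Counting
  open import Data.List.Membership.DecPropositional _≟_ using (_∉?_)

  module _ (3≤q : 3 ≤ q) (q-odd : q % 2 ≡ 1) (c : Carrier) (c≢0 : c ≢ 0#) (d : Carrier) (h : (d + 1#) * (d + 1#) ≡ - 1#) where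

    private
      c⁻¹ : Carrier
      c⁻¹ = c ⁻¹
      hc : c * c⁻¹ ≡ 1#
      hc = ⁻¹-inverse c c≢0
      2⁻¹ : Carrier
      2⁻¹ = (1# + 1#) ⁻¹
      h2 : (1# + 1#) * 2⁻¹ ≡ 1#
      h2 = ⁻¹-inverse (1# + 1#) (2≢0 q-odd)

    d+1≢0 : d + 1# ≢ 0#
    d+1≢0 d+1≡0 = 1≢0 (modulo₀ d+1≡0 (modulo h (solve 1 (λ d → # 1 := # 0 :+ (d :+ # 1) :* (:- # 1 :- d) :+ ((d :+ # 1) :* (d :+ # 1) :- :- # 1) :* # 1) refl d)))

    d≢0 : d ≢ 0#
    d≢0 d≡0 = 2≢0 q-odd (modulo₀ d≡0 (modulo h (solve 1 (λ d → # 1 :+ # 1 := # 0 :+ d :* (:- # 2 :- d) :+ ((d :+ # 1) :* (d :+ # 1) :- :- # 1) :* # 1) refl d)))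

    d+2≢0 : d + (1# + 1#) ≢ 0#
    d+2≢0 d+2≡0 = 2≢0 q-odd (modulo₀ d+2≡0 (modulo h (solve 1 (λ d → # 1 :+ # 1 := # 0 :+ (d :+ (# 1 :+ # 1)) :* :- d :+ ((d :+ # 1) :* (d :+ # 1) :- :- # 1) :* # 1) refl d)))

    open Evaluation 3≤q c c≢0 d d+1≢0
    open F₁-Points d≢0

    private
      [d+1]⁻¹ : Carrier
      [d+1]⁻¹ = (d + 1#) ⁻¹
      he : (d + 1#) * [d+1]⁻¹ ≡ 1#
      he = ⁻¹-inverse (d + 1#) d+1≢0

    L : Carrier → Carrier
    L x = - (d * x) - (d + (1# + 1#)) * c⁻¹

    L⁻¹ : Carrier → Carrier
    L⁻¹ y = (y + (d + (1# + 1#)) * c⁻¹) * (d + (1# + 1#)) * 2⁻¹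

    L∘L⁻¹ : ∀ y → L (L⁻¹ y) ≡ y
    L∘L⁻¹ y = modulo h (modulo h2 (solve 4 (λ 2⁻¹ c⁻¹ y d → :- (d :* ((y :+ (d :+ (# 1 :+ # 1)) :* c⁻¹) :* (d :+ (# 1 :+ # 1)) :* 2⁻¹)) :- (d :+ (# 1 :+ # 1)) :* c⁻¹ := y :+ ((d :+ # 1) :* (d :+ # 1) :- :- # 1) :* (:- (2⁻¹ :* y) :- # 2 :* 2⁻¹ :* c⁻¹ :- 2⁻¹ :* c⁻¹ :* d) :+ ((# 1 :+ # 1) :* 2⁻¹ :- # 1) :* (y :+ # 2 :* c⁻¹ :+ c⁻¹ :* d)) refl 2⁻¹ c⁻¹ y d))

    L⁻¹∘L : ∀ x → L⁻¹ (L x) ≡ x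
    L⁻¹∘L x = modulo h (modulo h2 (solve 4 (λ 2⁻¹ c⁻¹ x d → (:- (d :* x) :- (d :+ (# 1 :+ # 1)) :* c⁻¹ :+ (d :+ (# 1 :+ # 1)) :* c⁻¹) :* (d :+ (# 1 :+ # 1)) :* 2⁻¹ := x :+ ((d :+ # 1) :* (d :+ # 1) :- :- # 1) :* :- (2⁻¹ :* x) :+ ((# 1 :+ # 1) :* 2⁻¹ :- # 1) :* x) refl 2⁻¹ c⁻¹ x d))

    F₁≡L : ∀ x → x ≢ 0# → x ≢ (d + 1#) / c → x ≢ d / c → F₁ c d x ≡ L x
    F₁≡L x x≢0 x≢[d+1]/c x≢d/c =
      trans (cong (_+ x) (pw-chain (F₁-step₁ x≢0) (F₁-step₂ x≢0 x≢[d+1]/c) (pw-inverse 3≤q step₃) (pw-inverse 3≤q step₄)))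
            (modulo hc (solve 4 (λ c⁻¹ x c d → :- (((d :+ # 1) :* c :* x :+ # 1 :+ (d :+ # 1)) :* c⁻¹) :+ x := :- (d :* x) :- (d :+ (# 1 :+ # 1)) :* c⁻¹ :+ (c :* c⁻¹ :- # 1) :* (:- x :- x :* d)) refl c⁻¹ x c d))
      where
      u : Carrier
      u = c * x - (d + 1#)
      v : Carrier
      v = (d + 1#) * c * x + 1# + (d + 1#)
      u≢0 : u ≢ 0#
      u≢0 u≡0 = x≢[d+1]/c (modulo₀ u≡0 (modulo hc (solve 4 (λ c⁻¹ x c d → x := (d :+ # 1) :* c⁻¹ :+ (c :* x :- (d :+ # 1)) :* c⁻¹ :+ (c :* c⁻¹ :- # 1) :* :- x) refl c⁻¹ x c d)))
      v≢0 : v ≢ 0#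
      v≢0 v≡0 = x≢d/c (modulo₀ v≡0 (modulo hc (modulo h (solve 5 (λ [d+1]⁻¹ c⁻¹ x c d → x := d :* c⁻¹ :+ ((d :+ # 1) :* c :* x :+ # 1 :+ (d :+ # 1)) :* (:- c⁻¹ :- c⁻¹ :* d) :+ (c :* c⁻¹ :- # 1) :* (x :+ # 2 :* x :* d :+ x :* d :* d) :+ ((d :+ # 1) :* (d :+ # 1) :- :- # 1) :* (x :+ c⁻¹)) refl [d+1]⁻¹ c⁻¹ x c d))))
      step₃ : (x / u + d / c) * (c * u / v) ≡ 1#
      step₃ = modulo (⁻¹-inverse u u≢0) (modulo hc (modulo (⁻¹-inverse v v≢0) (modulo h (solve 6 (λ u⁻¹ v⁻¹ c⁻¹ x c d → (x :* u⁻¹ :+ d :* c⁻¹) :* (c :* (c :* x :- (d :+ # 1)) :* v⁻¹) := # 1 :+ ((c :* x :- (d :+ # 1)) :* u⁻¹ :- # 1) :* (v⁻¹ :* x :* c) :+ (c :* c⁻¹ :- # 1) :* (:- (v⁻¹ :* d) :- v⁻¹ :* d :* d :+ v⁻¹ :* x :* c :* d) :+ (((d :+ # 1) :* c :* x :+ # 1 :+ (d :+ # 1)) :* v⁻¹ :- # 1) :* # 1 :+ ((d :+ # 1) :* (d :+ # 1) :- :- # 1) :* :- v⁻¹) refl (u ⁻¹) (v ⁻¹) c⁻¹ x c d))))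
      step₄ : (c * u / v - c / (d + 1#)) * (- (v / c)) ≡ 1#
      step₄ = modulo (⁻¹-inverse v v≢0) (modulo hc (modulo he (modulo h (solve 6 (λ v⁻¹ [d+1]⁻¹ c⁻¹ x c d → (c :* (c :* x :- (d :+ # 1)) :* v⁻¹ :- c :* [d+1]⁻¹) :* :- (((d :+ # 1) :* c :* x :+ # 1 :+ (d :+ # 1)) :* c⁻¹) := # 1 :+ (((d :+ # 1) :* c :* x :+ # 1 :+ (d :+ # 1)) :* v⁻¹ :- # 1) :* (c⁻¹ :* c :+ c⁻¹ :* c :* d :- c⁻¹ :* x :* c :* c) :+ (c :* c⁻¹ :- # 1) :* (# 1 :+ d :- x :* c :+ # 2 :* [d+1]⁻¹ :+ [d+1]⁻¹ :* d :+ [d+1]⁻¹ :* x :* c :+ [d+1]⁻¹ :* x :* c :* d) :+ ((d :+ # 1) :* [d+1]⁻¹ :- # 1) :* (:- d :+ x :* c) :+ ((d :+ # 1) :* (d :+ # 1) :- :- # 1) :* [d+1]⁻¹) refl (v ⁻¹) [d+1]⁻¹ c⁻¹ x c d))))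

    F₁[[d+1]/c]≡-1/c : F₁ c d ((d + 1#) / c) ≡ - 1# / c
    F₁[[d+1]/c]≡-1/c = trans
      (cong (_+ (d + 1#) / c) (pw-chain F₁[[d+1]/c]-step₁ (pw-zero 3≤q (-‿inverseˡ c)) (pw-inverse 3≤q step₃) (pw-inverse 3≤q step₄)))
      (solve 2 (λ c⁻¹ d → :- ((d :+ (# 1 :+ # 1)) :* c⁻¹) :+ (d :+ # 1) :* c⁻¹ := :- # 1 :* c⁻¹) refl c⁻¹ d)
      where
      step₃ : (0# + d / c) * (- (c * (d + (1# + 1#)) * 2⁻¹)) ≡ 1#
      step₃ = modulo hc (modulo h (modulo h2 (solve 4 (λ 2⁻¹ c⁻¹ c d → (# 0 :+ d :* c⁻¹) :* :- (c :* (d :+ (# 1 :+ # 1)) :* 2⁻¹) := # 1 :+ (c :* c⁻¹ :- # 1) :* (:- (# 2 :* 2⁻¹ :* d) :- 2⁻¹ :* d :* d) :+ ((d :+ # 1) :* (d :+ # 1) :- :- # 1) :* :- 2⁻¹ :+ ((# 1 :+ # 1) :* 2⁻¹ :- # 1) :* # 1) refl 2⁻¹ c⁻¹ c d)))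
      step₄ : (- (c * (d + (1# + 1#)) * 2⁻¹) - c / (d + 1#)) * (- ((d + (1# + 1#)) / c)) ≡ 1#
      step₄ = modulo hc (modulo he (modulo h (modulo h2 (solve 5 (λ 2⁻¹ [d+1]⁻¹ c⁻¹ c d → (:- (c :* (d :+ (# 1 :+ # 1)) :* 2⁻¹) :- c :* [d+1]⁻¹) :* :- ((d :+ (# 1 :+ # 1)) :* c⁻¹) := # 1 :+ (c :* c⁻¹ :- # 1) :* (# 2 :* [d+1]⁻¹ :+ [d+1]⁻¹ :* d :+ # 4 :* 2⁻¹ :+ # 4 :* 2⁻¹ :* d :+ 2⁻¹ :* d :* d) :+ ((d :+ # 1) :* [d+1]⁻¹ :- # 1) :* (# 1 :- # 2 :* 2⁻¹ :- # 2 :* 2⁻¹ :* d) :+ ((d :+ # 1) :* (d :+ # 1) :- :- # 1) :* (2⁻¹ :+ # 2 :* 2⁻¹ :* [d+1]⁻¹) :+ ((# 1 :+ # 1) :* 2⁻¹ :- # 1) :* :- [d+1]⁻¹) refl 2⁻¹ [d+1]⁻¹ c⁻¹ c d))))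

    F₁[d/c]≡-1/c : F₁ c d (d / c) ≡ - 1# / c
    F₁[d/c]≡-1/c = trans
      (cong (_+ d / c) (pw-chain (pw-inverse 3≤q step₁) (pw-inverse 3≤q step₂) (pw-zero 3≤q (-‿inverseˡ (d / c))) pw[0-c/[d+1]]))
      (solve 2 (λ c⁻¹ d → :- ((d :+ # 1) :* c⁻¹) :+ d :* c⁻¹ := :- # 1 :* c⁻¹) refl c⁻¹ d)
      where
      step₁ : ((- (d / c)) / (d + 1#)) * (c * d * 2⁻¹) ≡ 1#
      step₁ = modulo hc (modulo he (modulo h (modulo h2 (solve 5 (λ 2⁻¹ [d+1]⁻¹ c⁻¹ c d → :- (d :* c⁻¹) :* [d+1]⁻¹ :* (c :* d :* 2⁻¹) := # 1 :+ (c :* c⁻¹ :- # 1) :* :- (2⁻¹ :* [d+1]⁻¹ :* d :* d) :+ ((d :+ # 1) :* [d+1]⁻¹ :- # 1) :* (# 2 :* 2⁻¹) :+ ((d :+ # 1) :* (d :+ # 1) :- :- # 1) :* :- (2⁻¹ :* [d+1]⁻¹) :+ ((# 1 :+ # 1) :* 2⁻¹ :- # 1) :* # 1) refl 2⁻¹ [d+1]⁻¹ c⁻¹ c d))))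
      step₂ : (c * d * 2⁻¹ + c) * (- (d / c)) ≡ 1#
      step₂ = modulo hc (modulo h (modulo h2 (solve 4 (λ 2⁻¹ c⁻¹ c d → (c :* d :* 2⁻¹ :+ c) :* :- (d :* c⁻¹) := # 1 :+ (c :* c⁻¹ :- # 1) :* (:- d :- 2⁻¹ :* d :* d) :+ ((d :+ # 1) :* (d :+ # 1) :- :- # 1) :* :- 2⁻¹ :+ ((# 1 :+ # 1) :* 2⁻¹ :- # 1) :* (# 1 :+ d)) refl 2⁻¹ c⁻¹ c d)))

    private
      m : Carrier
      m = - 1# / c
      X₁ : Carrier
      X₁ = d / c
      X₂ : Carrier
      X₂ = (- d - (1# + 1#)) / c

      m≢0 : m ≢ 0#
      m≢0 m≡0 = 1≢0 (modulo₀ m≡0 (modulo hc (solve 2 (λ c⁻¹ c → # 1 := # 0 :+ :- # 1 :* c⁻¹ :* :- c :+ (c :* c⁻¹ :- # 1) :* :- # 1) refl c⁻¹ c)))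
      m≢X₁ : m ≢ X₁
      m≢X₁ eq = d+1≢0 (modulo eq (modulo hc (solve 3 (λ c⁻¹ c d → d :+ # 1 := # 0 :+ (:- # 1 :* c⁻¹ :- d :* c⁻¹) :* :- c :+ (c :* c⁻¹ :- # 1) :* (:- # 1 :- d)) refl c⁻¹ c d)))
      m≢X₂ : m ≢ X₂
      m≢X₂ eq = d+1≢0 (modulo eq (modulo hc (solve 3 (λ c⁻¹ c d → d :+ # 1 := # 0 :+ (:- # 1 :* c⁻¹ :- (:- d :- (# 1 :+ # 1)) :* c⁻¹) :* c :+ (c :* c⁻¹ :- # 1) :* (:- # 1 :- d)) refl c⁻¹ c d)))
      0≢X₂ : 0# ≢ X₂
      0≢X₂ 0≡ = d+2≢0 (modulo₀ (sym 0≡) (modulo hc (solve 3 (λ c⁻¹ c d → d :+ (# 1 :+ # 1) := # 0 :+ (:- d :- (# 1 :+ # 1)) :* c⁻¹ :* :- c :+ (c :* c⁻¹ :- # 1) :* (:- # 2 :- d)) refl c⁻¹ c d)))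

    open AgreesWithBijectionOffThreePoints (F₁ c d) L L⁻¹ L∘L⁻¹ L⁻¹∘L 0# ((d + 1#) / c) (d / c)
      0≢[d+1]/c 0≢d/c [d+1]/c≢d/c F₁≡L F₁[0]≡0 F₁[[d+1]/c]≡-1/c F₁[d/c]≡-1/c
      (solve 2 (λ c⁻¹ d → :- (d :* # 0) :- (d :+ (# 1 :+ # 1)) :* c⁻¹ := (:- d :- (# 1 :+ # 1)) :* c⁻¹) refl c⁻¹ d) (modulo h (solve 3 (λ c⁻¹ c d → :- (d :* ((d :+ # 1) :* c⁻¹)) :- (d :+ (# 1 :+ # 1)) :* c⁻¹ := # 0 :+ ((d :+ # 1) :* (d :+ # 1) :- :- # 1) :* :- c⁻¹) refl c⁻¹ c d)) (modulo h (solve 3 (λ c⁻¹ c d → :- (d :* (d :* c⁻¹)) :- (d :+ (# 1 :+ # 1)) :* c⁻¹ := d :* c⁻¹ :+ ((d :+ # 1) :* (d :+ # 1) :- :- # 1) :* :- c⁻¹) refl c⁻¹ c d))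
      using (preimageCount-by)

    preimageCount-m : preimageCount (F₁ c d) m ≡ 3
    preimageCount-m = preimageCount-by m (𝟙-no (0# ≟ m) (≢-sym m≢0)) (𝟙-yes (m ≟ m) refl) (𝟙-yes (m ≟ m) refl)
                                         (𝟙-yes (m ∉? _) (∉₃ m≢X₂ m≢0 m≢X₁))

    preimageCount-X₁ : preimageCount (F₁ c d) X₁ ≡ 0
    preimageCount-X₁ = preimageCount-by X₁ (𝟙-no (0# ≟ X₁) 0≢d/c) (𝟙-no (m ≟ X₁) m≢X₁) (𝟙-no (m ≟ X₁) m≢X₁)
                                           (𝟙-no (X₁ ∉? _) (λ X₁∉ → X₁∉ (there (there (here refl)))))

    preimageCount-X₂ : preimageCount (F₁ c d) X₂ ≡ 0
    preimageCount-X₂ = preimageCount-by X₂ (𝟙-no (0# ≟ X₂) 0≢X₂) (𝟙-no (m ≟ X₂) m≢X₂) (𝟙-no (m ≟ X₂) m≢X₂)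
                                           (𝟙-no (X₂ ∉? _) (λ X₂∉ → X₂∉ (here refl)))

    preimageCount-other : ∀ β → β ≢ m → β ≢ X₁ → β ≢ X₂ → preimageCount (F₁ c d) β ≡ 1
    preimageCount-other β β≢m β≢X₁ β≢X₂ with β ≟ 0#
    ... | yes refl = preimageCount-by 0# (𝟙-yes (0# ≟ 0#) refl) (𝟙-no (m ≟ 0#) m≢0) (𝟙-no (m ≟ 0#) m≢0)
                                         (𝟙-no (0# ∉? _) (λ 0∉ → 0∉ (there (here refl))))
    ... | no β≢0 = preimageCount-by β (𝟙-no (0# ≟ β) (≢-sym β≢0)) (𝟙-no (m ≟ β) (≢-sym β≢m)) (𝟙-no (m ≟ β) (≢-sym β≢m))
                                      (𝟙-yes (β ∉? _) (∉₃ β≢X₂ β≢0 β≢X₁))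

    InValueSet⇔ : ∀ β → InValueSet (F₁ c d) β ⇔ (β ≢ X₁ × β ≢ X₂)
    InValueSet⇔ β = mk⇔ to from
      where
      count≢0⇔ : InValueSet (F₁ c d) β ⇔ preimageCount (F₁ c d) β ≢ 0
      count≢0⇔ = InValueSet⇔preimageCount≢0 (F₁ c d) β
      to : InValueSet (F₁ c d) β → β ≢ X₁ × β ≢ X₂
      to β∈V = (λ { refl → Equivalence.to count≢0⇔ β∈V preimageCount-X₁ })
             , (λ { refl → Equivalence.to count≢0⇔ β∈V preimageCount-X₂ })
      from : β ≢ X₁ × β ≢ X₂ → InValueSet (F₁ c d) β
      from (β≢X₁ , β≢X₂) with β ≟ m
      ... | yes refl = Equivalence.from count≢0⇔ (λ count≡0 → ℕₚ.1+n≢0 (trans (sym preimageCount-m) count≡0))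
      ... | no β≢m = Equivalence.from count≢0⇔ (λ count≡0 → ℕₚ.1+n≢0 (trans (sym (preimageCount-other β β≢m β≢X₁ β≢X₂)) count≡0))

    preimageCount≤3 : ∀ β → preimageCount (F₁ c d) β ℕ.≤ 3
    preimageCount≤3 β with β ≟ m | β ≟ X₁ | β ≟ X₂
    ... | yes refl | _ | _ = ℕₚ.≤-reflexive preimageCount-m
    ... | no _ | yes refl | _ = subst (ℕ._≤ 3) (sym preimageCount-X₁) z≤n
    ... | no _ | no _ | yes refl = subst (ℕ._≤ 3) (sym preimageCount-X₂) z≤n
    ... | no β≢m | no β≢X₁ | no β≢X₂ = subst (ℕ._≤ 3) (sym (preimageCount-other β β≢m β≢X₁ β≢X₂)) (s≤s z≤n)

    partII : (∀ β → InValueSet (F₁ c d) β ⇔ (β ≢ d / c × β ≢ (- d - (1# + 1#)) / c))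
             × preimageCount (F₁ c d) (- 1# / c) ≡ 3
             × (∀ β → InValueSet (F₁ c d) β → β ≢ - 1# / c → preimageCount (F₁ c d) β ≡ 1)
             × maxCount (F₁ c d) ≡ 3
    partII = InValueSet⇔ , preimageCount-m
           , (λ β β∈V β≢m → let (β≢X₁ , β≢X₂) = Equivalence.to (InValueSet⇔ β) β∈V in preimageCount-other β β≢m β≢X₁ β≢X₂)
           , maxCount≡ (F₁ c d) preimageCount≤3 m preimageCount-m

module PartIII (K : FiniteField) where

  open import Data.Nat as ℕ using (ℕ; _≤_; _%_; _∸_; s≤s; z≤n)
  import Data.Nat.Properties as ℕₚ
  open import Data.Nat.DivMod using (m∣n⇒o%n%m≡o%m)
  open import Data.Nat.Divisibility using (divides)
  open import Data.Product using (_×_; _,_)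
  open import Data.Sum using (_⊎_; inj₁; inj₂)
  open import Data.Empty using (⊥-elim)
  open import Data.List using (List; []; _∷_)
  open import Data.List.Relation.Unary.Any using (here; there)
  open import Data.List.Relation.Unary.All using ([]; _∷_)
  open import Data.List.Relation.Unary.Unique.Propositional using (Unique; []; _∷_)
  open import Data.List.Membership.Propositional using (_∈_; _∉_)
  open import Function using (_∘_)
  open import Function.Bundles using (_⇔_; mk⇔; Equivalence)
  open import Relation.Nullary using (yes; no)
  open import Relation.Binary.PropositionalEquality
  open FF K
  open FiniteFieldFacts K
  open SharedEvaluations K
  open Preimages K
  open Counting
  open import Data.List.Membership.DecPropositional _≟_ using (_∈?_; _∉?_)

  module _ (3≤q : 3 ≤ q) (q-odd : q % 2 ≡ 1) (q%12≡11 : q % 12 ≡ 11) (c : Carrier) (c≢0 : c ≢ 0#) (d : Carrier)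
           (d≢-1 : d ≢ - 1#) (d≢-1/2 : d ≢ - (1# / (1# + 1#))) (d≢0 : d ≢ 0#) where

    private
      c⁻¹ : Carrier
      c⁻¹ = c ⁻¹
      hc : c * c⁻¹ ≡ 1#
      hc = ⁻¹-inverse c c≢0
      d⁻¹ : Carrier
      d⁻¹ = d ⁻¹
      hd : d * d⁻¹ ≡ 1#
      hd = ⁻¹-inverse d d≢0
      2⁻¹ : Carrier
      2⁻¹ = (1# + 1#) ⁻¹
      h2 : (1# + 1#) * 2⁻¹ ≡ 1#
      h2 = ⁻¹-inverse (1# + 1#) (2≢0 q-odd)

    d+1≢0 : d + 1# ≢ 0#
    d+1≢0 d+1≡0 = d≢-1 (modulo₀ d+1≡0 (solve 1 (λ d → d := :- # 1 :+ (d :+ # 1) :* # 1) refl d))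

    2d+1≢0 : (1# + 1#) * d + 1# ≢ 0#
    2d+1≢0 2d+1≡0 = d≢-1/2 (modulo₀ 2d+1≡0 (modulo h2 (solve 2 (λ 2⁻¹ d → d := :- (# 1 :* 2⁻¹) :+ ((# 1 :+ # 1) :* d :+ # 1) :* 2⁻¹ :+ ((# 1 :+ # 1) :* 2⁻¹ :- # 1) :* :- d) refl 2⁻¹ d)))

    d[d+1]≢0 : d * (d + 1#) ≢ 0#
    d[d+1]≢0 = *-≢0 d≢0 d+1≢0

    open Evaluation 3≤q c c≢0 d d+1≢0

    private
      [d+1]⁻¹ : Carrier
      [d+1]⁻¹ = (d + 1#) ⁻¹
      he : (d + 1#) * [d+1]⁻¹ ≡ 1#
      he = ⁻¹-inverse (d + 1#) d+1≢0
      [d[d+1]]⁻¹ : Carrier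
      [d[d+1]]⁻¹ = (d * (d + 1#)) ⁻¹
      hD : d * (d + 1#) * [d[d+1]]⁻¹ ≡ 1#
      hD = ⁻¹-inverse (d * (d + 1#)) d[d+1]≢0
      [2d+1]⁻¹ : Carrier
      [2d+1]⁻¹ = ((1# + 1#) * d + 1#) ⁻¹
      hs : ((1# + 1#) * d + 1#) * [2d+1]⁻¹ ≡ 1#
      hs = ⁻¹-inverse _ 2d+1≢0

    L : Carrier → Carrier
    L x = (d + 1#) * x / d + d * (d + 1#) / c + x

    L⁻¹ : Carrier → Carrier
    L⁻¹ y = (y - d * (d + 1#) / c) * d / ((1# + 1#) * d + 1#)

    L∘L⁻¹ : ∀ y → L (L⁻¹ y) ≡ y
    L∘L⁻¹ y = modulo hs (modulo hd (solve 5 (λ [2d+1]⁻¹ d⁻¹ c⁻¹ y d → (d :+ # 1) :* ((y :- d :* (d :+ # 1) :* c⁻¹) :* d :* [2d+1]⁻¹) :* d⁻¹ :+ d :* (d :+ # 1) :* c⁻¹ :+ (y :- d :* (d :+ # 1) :* c⁻¹) :* d :* [2d+1]⁻¹ := y :+ (((# 1 :+ # 1) :* d :+ # 1) :* [2d+1]⁻¹ :- # 1) :* (y :- c⁻¹ :* d :* d :- d⁻¹ :* c⁻¹ :* d :* d) :+ (d :* d⁻¹ :- # 1) :* (:- (c⁻¹ :* d) :+ [2d+1]⁻¹ :* y :+ [2d+1]⁻¹ :* y :* d :- [2d+1]⁻¹ :* c⁻¹ :* d :* d :* d)) refl [2d+1]⁻¹ d⁻¹ c⁻¹ y d))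

    L⁻¹∘L : ∀ x → L⁻¹ (L x) ≡ x
    L⁻¹∘L x = modulo hs (modulo hd (solve 5 (λ [2d+1]⁻¹ d⁻¹ c⁻¹ x d → ((d :+ # 1) :* x :* d⁻¹ :+ d :* (d :+ # 1) :* c⁻¹ :+ x :- d :* (d :+ # 1) :* c⁻¹) :* d :* [2d+1]⁻¹ := x :+ (((# 1 :+ # 1) :* d :+ # 1) :* [2d+1]⁻¹ :- # 1) :* x :+ (d :* d⁻¹ :- # 1) :* ([2d+1]⁻¹ :* x :+ [2d+1]⁻¹ :* x :* d)) refl [2d+1]⁻¹ d⁻¹ c⁻¹ x d))

    F₃≡L : ∀ x → x ≢ 0# → x ≢ - (d * (d + 1#)) / c → x ≢ - (d * d) / c → F₃ c d x ≡ L x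
    F₃≡L x x≢0 x≢S₂ x≢S₃ =
      cong (_+ x) (pw-chain (pw-inverse 3≤q step₁) (pw-inverse 3≤q step₂) (pw-inverse 3≤q step₃) (pw-inverse 3≤q step₄))
      where
      u : Carrier
      u = c * x + d * (d + 1#)
      v : Carrier
      v = (d + 1#) * c * x + d * (d * (d + 1#))
      hx : x * x ⁻¹ ≡ 1#
      hx = ⁻¹-inverse x x≢0
      u≢0 : u ≢ 0#
      u≢0 u≡0 = x≢S₂ (modulo₀ u≡0 (modulo hc (solve 4 (λ c⁻¹ x c d → x := :- (d :* (d :+ # 1)) :* c⁻¹ :+ (c :* x :+ d :* (d :+ # 1)) :* c⁻¹ :+ (c :* c⁻¹ :- # 1) :* :- x) refl c⁻¹ x c d)))
      v≢0 : v ≢ 0#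
      v≢0 v≡0 = x≢S₃ (modulo₀ v≡0 (modulo hc (modulo he (solve 5 (λ [d+1]⁻¹ c⁻¹ x c d → x := :- (d :* d) :* c⁻¹ :+ ((d :+ # 1) :* c :* x :+ d :* (d :* (d :+ # 1))) :* ([d+1]⁻¹ :* c⁻¹) :+ (c :* c⁻¹ :- # 1) :* (:- ([d+1]⁻¹ :* x) :- [d+1]⁻¹ :* x :* d) :+ ((d :+ # 1) :* [d+1]⁻¹ :- # 1) :* (:- x :- c⁻¹ :* d :* d)) refl [d+1]⁻¹ c⁻¹ x c d))))
      step₁ : (x / (d * (d + 1#))) * (d * (d + 1#) / x) ≡ 1#
      step₁ = modulo hD (modulo hx (solve 4 (λ x⁻¹ [d[d+1]]⁻¹ x d → x :* [d[d+1]]⁻¹ :* (d :* (d :+ # 1) :* x⁻¹) := # 1 :+ (d :* (d :+ # 1) :* [d[d+1]]⁻¹ :- # 1) :* (x⁻¹ :* x) :+ (x :* x⁻¹ :- # 1) :* # 1) refl (x ⁻¹) [d[d+1]]⁻¹ x d))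
      step₂ : (d * (d + 1#) / x + c) * (x / u) ≡ 1#
      step₂ = modulo hx (modulo (⁻¹-inverse u u≢0) (solve 5 (λ x⁻¹ u⁻¹ x c d → (d :* (d :+ # 1) :* x⁻¹ :+ c) :* (x :* u⁻¹) := # 1 :+ (x :* x⁻¹ :- # 1) :* (u⁻¹ :* d :+ u⁻¹ :* d :* d) :+ ((c :* x :+ d :* (d :+ # 1)) :* u⁻¹ :- # 1) :* # 1) refl (x ⁻¹) (u ⁻¹) x c d))
      step₃ : (x / u + d / c) * (c * u / v) ≡ 1#
      step₃ = modulo (⁻¹-inverse u u≢0) (modulo hc (modulo (⁻¹-inverse v v≢0) (solve 6 (λ u⁻¹ v⁻¹ c⁻¹ x c d → (x :* u⁻¹ :+ d :* c⁻¹) :* (c :* (c :* x :+ d :* (d :+ # 1)) :* v⁻¹) := # 1 :+ ((c :* x :+ d :* (d :+ # 1)) :* u⁻¹ :- # 1) :* (v⁻¹ :* x :* c) :+ (c :* c⁻¹ :- # 1) :* (v⁻¹ :* d :* d :+ v⁻¹ :* d :* d :* d :+ v⁻¹ :* x :* c :* d) :+ (((d :+ # 1) :* c :* x :+ d :* (d :* (d :+ # 1))) :* v⁻¹ :- # 1) :* # 1) refl (u ⁻¹) (v ⁻¹) c⁻¹ x c d)))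
      step₄ : (c * u / v - c / (d + 1#)) * ((d + 1#) * x / d + d * (d + 1#) / c) ≡ 1#
      step₄ = modulo (⁻¹-inverse v v≢0) (modulo hc (modulo he (modulo hd (solve 7 (λ v⁻¹ [d+1]⁻¹ d⁻¹ c⁻¹ x c d → (c :* (c :* x :+ d :* (d :+ # 1)) :* v⁻¹ :- c :* [d+1]⁻¹) :* ((d :+ # 1) :* x :* d⁻¹ :+ d :* (d :+ # 1) :* c⁻¹) := # 1 :+ (((d :+ # 1) :* c :* x :+ d :* (d :* (d :+ # 1))) :* v⁻¹ :- # 1) :* (c⁻¹ :* c :* d :+ d⁻¹ :* d :+ d⁻¹ :* x :* c) :+ (c :* c⁻¹ :- # 1) :* (d :- [d+1]⁻¹ :* d :- [d+1]⁻¹ :* d :* d :+ v⁻¹ :* d :* d :+ v⁻¹ :* d :* d :* d) :+ ((d :+ # 1) :* [d+1]⁻¹ :- # 1) :* (:- d :- d⁻¹ :* x :* c) :+ (d :* d⁻¹ :- # 1) :* (# 1 :- v⁻¹ :* d :* d :- v⁻¹ :* d :* d :* d)) refl (v ⁻¹) [d+1]⁻¹ d⁻¹ c⁻¹ x c d))))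

    F₃[S₂]≡0 : F₃ c d (- (d * (d + 1#)) / c) ≡ 0#
    F₃[S₂]≡0 = trans
      (cong (_+ - (d * (d + 1#)) / c) (pw-chain (pw-inverse 3≤q step₁) (pw-zero 3≤q (-‿inverseˡ c)) (pw-inverse 3≤q step₃) (pw-inverse 3≤q step₄)))
      (solve 2 (λ c⁻¹ d → d :* (d :+ # 1) :* c⁻¹ :+ :- (d :* (d :+ # 1)) :* c⁻¹ := # 0) refl c⁻¹ d)
      where
      step₁ : ((- (d * (d + 1#)) / c) / (d * (d + 1#))) * (- c) ≡ 1#
      step₁ = modulo hD (modulo hc (solve 4 (λ [d[d+1]]⁻¹ c⁻¹ c d → :- (d :* (d :+ # 1)) :* c⁻¹ :* [d[d+1]]⁻¹ :* :- c := # 1 :+ (d :* (d :+ # 1) :* [d[d+1]]⁻¹ :- # 1) :* (c⁻¹ :* c) :+ (c :* c⁻¹ :- # 1) :* # 1) refl [d[d+1]]⁻¹ c⁻¹ c d))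
      step₃ : (0# + d / c) * (c / d) ≡ 1#
      step₃ = modulo hc (modulo hd (solve 4 (λ d⁻¹ c⁻¹ c d → (# 0 :+ d :* c⁻¹) :* (c :* d⁻¹) := # 1 :+ (c :* c⁻¹ :- # 1) :* (d⁻¹ :* d) :+ (d :* d⁻¹ :- # 1) :* # 1) refl d⁻¹ c⁻¹ c d))
      step₄ : (c / d - c / (d + 1#)) * (d * (d + 1#) / c) ≡ 1#
      step₄ = modulo hc (modulo he (modulo hd (solve 5 (λ [d+1]⁻¹ d⁻¹ c⁻¹ c d → (c :* d⁻¹ :- c :* [d+1]⁻¹) :* (d :* (d :+ # 1) :* c⁻¹) := # 1 :+ (c :* c⁻¹ :- # 1) :* (d⁻¹ :* d :+ d⁻¹ :* d :* d :- [d+1]⁻¹ :* d :- [d+1]⁻¹ :* d :* d) :+ ((d :+ # 1) :* [d+1]⁻¹ :- # 1) :* :- d :+ (d :* d⁻¹ :- # 1) :* (# 1 :+ d)) refl [d+1]⁻¹ d⁻¹ c⁻¹ c d)))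

    F₃[S₃]≡T : F₃ c d (- (d * d) / c) ≡ (- (d * d) - d - 1#) / c
    F₃[S₃]≡T = trans
      (cong (_+ - (d * d) / c) (pw-chain (pw-inverse 3≤q step₁) (pw-inverse 3≤q step₂) (pw-zero 3≤q (-‿inverseˡ (d / c))) pw[0-c/[d+1]]))
      (solve 2 (λ c⁻¹ d → :- ((d :+ # 1) :* c⁻¹) :+ :- (d :* d) :* c⁻¹ := (:- (d :* d) :- d :- # 1) :* c⁻¹) refl c⁻¹ d)
      where
      step₁ : ((- (d * d) / c) / (d * (d + 1#))) * (- (c * (d + 1#) / d)) ≡ 1#
      step₁ = modulo hD (modulo hc (modulo hd (solve 5 (λ [d[d+1]]⁻¹ d⁻¹ c⁻¹ c d → :- (d :* d) :* c⁻¹ :* [d[d+1]]⁻¹ :* :- (c :* (d :+ # 1) :* d⁻¹) := # 1 :+ (d :* (d :+ # 1) :* [d[d+1]]⁻¹ :- # 1) :* (d⁻¹ :* c⁻¹ :* c :* d) :+ (c :* c⁻¹ :- # 1) :* (d⁻¹ :* d) :+ (d :* d⁻¹ :- # 1) :* # 1) refl [d[d+1]]⁻¹ d⁻¹ c⁻¹ c d)))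
      step₂ : (- (c * (d + 1#) / d) + c) * (- (d / c)) ≡ 1#
      step₂ = modulo hc (modulo hd (solve 4 (λ d⁻¹ c⁻¹ c d → (:- (c :* (d :+ # 1) :* d⁻¹) :+ c) :* :- (d :* c⁻¹) := # 1 :+ (c :* c⁻¹ :- # 1) :* (:- d :+ d⁻¹ :* d :+ d⁻¹ :* d :* d) :+ (d :* d⁻¹ :- # 1) :* (# 1 :+ d)) refl d⁻¹ c⁻¹ c d))

    private
      S₂ : Carrier
      S₂ = - (d * (d + 1#)) / c
      S₃ : Carrier
      S₃ = - (d * d) / c
      T : Carrier
      T = (- (d * d) - d - 1#) / c
      Y₁ : Carrier
      Y₁ = d * (d + 1#) / c
      Y₂ : Carrier
      Y₂ = - ((d + 1#) * (d + 1#)) / c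
      Y₃ : Carrier
      Y₃ = - (d * d) / c

      q%4≡3 : q % 4 ≡ 3
      q%4≡3 = trans (sym (m∣n⇒o%n%m≡o%m 4 12 q (divides 3 refl))) (cong (_% 4) q%12≡11)
      q%3≡2 : q % 3 ≡ 2
      q%3≡2 = trans (sym (m∣n⇒o%n%m≡o%m 3 12 q (divides 4 refl))) (cong (_% 3) q%12≡11)

      0≢S₂ : 0# ≢ S₂
      0≢S₂ 0≡ = d[d+1]≢0 (modulo₀ (sym 0≡) (modulo hc (solve 3 (λ c⁻¹ c d → d :* (d :+ # 1) := # 0 :+ :- (d :* (d :+ # 1)) :* c⁻¹ :* :- c :+ (c :* c⁻¹ :- # 1) :* (:- d :- d :* d)) refl c⁻¹ c d)))
      0≢S₃ : 0# ≢ S₃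
      0≢S₃ 0≡ = 1≢0 (modulo₀ (sym 0≡) (modulo hc (modulo hd (solve 4 (λ d⁻¹ c⁻¹ c d → # 1 := # 0 :+ :- (d :* d) :* c⁻¹ :* :- (d⁻¹ :* d⁻¹ :* c) :+ (c :* c⁻¹ :- # 1) :* :- (d⁻¹ :* d⁻¹ :* d :* d) :+ (d :* d⁻¹ :- # 1) :* (:- # 1 :- d⁻¹ :* d)) refl d⁻¹ c⁻¹ c d))))
      S₂≢S₃ : S₂ ≢ S₃
      S₂≢S₃ eq = 1≢0 (modulo eq (modulo hc (modulo hd (solve 4 (λ d⁻¹ c⁻¹ c d → # 1 := # 0 :+ (:- (d :* (d :+ # 1)) :* c⁻¹ :- :- (d :* d) :* c⁻¹) :* :- (d⁻¹ :* c) :+ (c :* c⁻¹ :- # 1) :* :- (d⁻¹ :* d) :+ (d :* d⁻¹ :- # 1) :* :- # 1) refl d⁻¹ c⁻¹ c d))))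

      -- d² + d + 1 = 0 would need a primitive cube root of unity, and 2d² + 2d + 1 = 0 a square root (2d + 1) of -1.
      T≢0 : T ≢ 0#
      T≢0 T≡0 = no-primitive-cube-root q%3≡2 d (modulo₀ T≡0 (modulo hc (solve 3 (λ c⁻¹ c d → d :* d :+ d :+ # 1 := # 0 :+ (:- (d :* d) :- d :- # 1) :* c⁻¹ :* :- c :+ (c :* c⁻¹ :- # 1) :* (:- # 1 :- d :- d :* d)) refl c⁻¹ c d)))
      Y₁≢0 : Y₁ ≢ 0#
      Y₁≢0 Y₁≡0 = d[d+1]≢0 (modulo₀ Y₁≡0 (modulo hc (solve 3 (λ c⁻¹ c d → d :* (d :+ # 1) := # 0 :+ d :* (d :+ # 1) :* c⁻¹ :* c :+ (c :* c⁻¹ :- # 1) :* (:- d :- d :* d)) refl c⁻¹ c d)))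
      Y₂≢0 : Y₂ ≢ 0#
      Y₂≢0 Y₂≡0 = 1≢0 (modulo₀ Y₂≡0 (modulo hc (modulo he (solve 4 (λ [d+1]⁻¹ c⁻¹ c d → # 1 := # 0 :+ :- ((d :+ # 1) :* (d :+ # 1)) :* c⁻¹ :* :- ([d+1]⁻¹ :* [d+1]⁻¹ :* c) :+ (c :* c⁻¹ :- # 1) :* (:- ([d+1]⁻¹ :* [d+1]⁻¹) :- # 2 :* [d+1]⁻¹ :* [d+1]⁻¹ :* d :- [d+1]⁻¹ :* [d+1]⁻¹ :* d :* d) :+ ((d :+ # 1) :* [d+1]⁻¹ :- # 1) :* (:- # 1 :- [d+1]⁻¹ :- [d+1]⁻¹ :* d)) refl [d+1]⁻¹ c⁻¹ c d))))
      Y₃≢0 : Y₃ ≢ 0#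
      Y₃≢0 Y₃≡0 = 0≢S₃ (sym Y₃≡0)
      T≢Y₁ : T ≢ Y₁
      T≢Y₁ eq = -1-nonsquare q%4≡3 ((1# + 1#) * d + 1#) (modulo₀ (modulo eq (modulo hc (solve 3 (λ c⁻¹ c d → (# 1 :+ # 1) :* (d :* d) :+ (# 1 :+ # 1) :* d :+ # 1 := # 0 :+ ((:- (d :* d) :- d :- # 1) :* c⁻¹ :- d :* (d :+ # 1) :* c⁻¹) :* :- c :+ (c :* c⁻¹ :- # 1) :* (:- # 1 :- # 2 :* d :- # 2 :* d :* d)) refl c⁻¹ c d))) (solve 1 (λ d → ((# 1 :+ # 1) :* d :+ # 1) :* ((# 1 :+ # 1) :* d :+ # 1) := :- # 1 :+ ((# 1 :+ # 1) :* (d :* d) :+ (# 1 :+ # 1) :* d :+ # 1) :* # 2) refl d))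
      T≢Y₂ : T ≢ Y₂
      T≢Y₂ eq = 1≢0 (modulo eq (modulo hc (modulo hd (solve 4 (λ d⁻¹ c⁻¹ c d → # 1 := # 0 :+ ((:- (d :* d) :- d :- # 1) :* c⁻¹ :- :- ((d :+ # 1) :* (d :+ # 1)) :* c⁻¹) :* (d⁻¹ :* c) :+ (c :* c⁻¹ :- # 1) :* :- (d⁻¹ :* d) :+ (d :* d⁻¹ :- # 1) :* :- # 1) refl d⁻¹ c⁻¹ c d))))
      T≢Y₃ : T ≢ Y₃
      T≢Y₃ eq = 1≢0 (modulo eq (modulo hc (modulo he (solve 4 (λ [d+1]⁻¹ c⁻¹ c d → # 1 := # 0 :+ ((:- (d :* d) :- d :- # 1) :* c⁻¹ :- :- (d :* d) :* c⁻¹) :* :- ([d+1]⁻¹ :* c) :+ (c :* c⁻¹ :- # 1) :* (:- [d+1]⁻¹ :- [d+1]⁻¹ :* d) :+ ((d :+ # 1) :* [d+1]⁻¹ :- # 1) :* :- # 1) refl [d+1]⁻¹ c⁻¹ c d))))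
      Y₁≢Y₂ : Y₁ ≢ Y₂
      Y₁≢Y₂ eq = 1≢0 (modulo eq (modulo hc (modulo he (modulo hs (solve 5 (λ [2d+1]⁻¹ [d+1]⁻¹ c⁻¹ c d → # 1 := # 0 :+ (d :* (d :+ # 1) :* c⁻¹ :- :- ((d :+ # 1) :* (d :+ # 1)) :* c⁻¹) :* ([2d+1]⁻¹ :* [d+1]⁻¹ :* c) :+ (c :* c⁻¹ :- # 1) :* (:- ([2d+1]⁻¹ :* [d+1]⁻¹) :- # 3 :* [2d+1]⁻¹ :* [d+1]⁻¹ :* d :- # 2 :* [2d+1]⁻¹ :* [d+1]⁻¹ :* d :* d) :+ ((d :+ # 1) :* [d+1]⁻¹ :- # 1) :* (:- [2d+1]⁻¹ :- # 2 :* [2d+1]⁻¹ :* d) :+ (((# 1 :+ # 1) :* d :+ # 1) :* [2d+1]⁻¹ :- # 1) :* :- # 1) refl [2d+1]⁻¹ [d+1]⁻¹ c⁻¹ c d)))))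
      Y₁≢Y₃ : Y₁ ≢ Y₃
      Y₁≢Y₃ eq = 1≢0 (modulo eq (modulo hc (modulo hd (modulo hs (solve 5 (λ [2d+1]⁻¹ d⁻¹ c⁻¹ c d → # 1 := # 0 :+ (d :* (d :+ # 1) :* c⁻¹ :- :- (d :* d) :* c⁻¹) :* ([2d+1]⁻¹ :* d⁻¹ :* c) :+ (c :* c⁻¹ :- # 1) :* (:- ([2d+1]⁻¹ :* d⁻¹ :* d) :- # 2 :* [2d+1]⁻¹ :* d⁻¹ :* d :* d) :+ (d :* d⁻¹ :- # 1) :* (:- [2d+1]⁻¹ :- # 2 :* [2d+1]⁻¹ :* d) :+ (((# 1 :+ # 1) :* d :+ # 1) :* [2d+1]⁻¹ :- # 1) :* :- # 1) refl [2d+1]⁻¹ d⁻¹ c⁻¹ c d)))))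
      Y₂≢Y₃ : Y₂ ≢ Y₃
      Y₂≢Y₃ eq = 1≢0 (modulo eq (modulo hc (modulo hs (solve 4 (λ [2d+1]⁻¹ c⁻¹ c d → # 1 := # 0 :+ (:- ((d :+ # 1) :* (d :+ # 1)) :* c⁻¹ :- :- (d :* d) :* c⁻¹) :* :- ([2d+1]⁻¹ :* c) :+ (c :* c⁻¹ :- # 1) :* (:- [2d+1]⁻¹ :- # 2 :* [2d+1]⁻¹ :* d) :+ (((# 1 :+ # 1) :* d :+ # 1) :* [2d+1]⁻¹ :- # 1) :* :- # 1) refl [2d+1]⁻¹ c⁻¹ c d))))

    open AgreesWithBijectionOffThreePoints (F₃ c d) L L⁻¹ L∘L⁻¹ L⁻¹∘L 0# S₂ S₃ 0≢S₂ 0≢S₃ S₂≢S₃ F₃≡L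
      F₃[0]≡0 F₃[S₂]≡0 F₃[S₃]≡T
      (solve 3 (λ d⁻¹ c⁻¹ d → (d :+ # 1) :* # 0 :* d⁻¹ :+ d :* (d :+ # 1) :* c⁻¹ :+ # 0 := d :* (d :+ # 1) :* c⁻¹) refl d⁻¹ c⁻¹ d) (modulo hd (solve 3 (λ d⁻¹ c⁻¹ d → (d :+ # 1) :* (:- (d :* (d :+ # 1)) :* c⁻¹) :* d⁻¹ :+ d :* (d :+ # 1) :* c⁻¹ :+ :- (d :* (d :+ # 1)) :* c⁻¹ := :- ((d :+ # 1) :* (d :+ # 1)) :* c⁻¹ :+ (d :* d⁻¹ :- # 1) :* (:- c⁻¹ :- # 2 :* c⁻¹ :* d :- c⁻¹ :* d :* d)) refl d⁻¹ c⁻¹ d)) (modulo hd (solve 3 (λ d⁻¹ c⁻¹ d → (d :+ # 1) :* (:- (d :* d) :* c⁻¹) :* d⁻¹ :+ d :* (d :+ # 1) :* c⁻¹ :+ :- (d :* d) :* c⁻¹ := :- (d :* d) :* c⁻¹ :+ (d :* d⁻¹ :- # 1) :* (:- (c⁻¹ :* d) :- c⁻¹ :* d :* d)) refl d⁻¹ c⁻¹ d))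
      using (preimageCount-by)

    Ys : List Carrier
    Ys = Y₁ ∷ Y₂ ∷ Y₃ ∷ []

    exceptional : List Carrier
    exceptional = 0# ∷ T ∷ Ys

    preimageCount-0 : preimageCount (F₃ c d) 0# ≡ 3
    preimageCount-0 = preimageCount-by 0# (𝟙-yes (0# ≟ 0#) refl) (𝟙-yes (0# ≟ 0#) refl) (𝟙-no (T ≟ 0#) T≢0)
                                          (𝟙-yes (0# ∉? Ys) (∉₃ (≢-sym Y₁≢0) (≢-sym Y₂≢0) (≢-sym Y₃≢0)))

    preimageCount-T : preimageCount (F₃ c d) T ≡ 2
    preimageCount-T = preimageCount-by T (𝟙-no (0# ≟ T) (≢-sym T≢0)) (𝟙-no (0# ≟ T) (≢-sym T≢0)) (𝟙-yes (T ≟ T) refl)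
                                         (𝟙-yes (T ∉? Ys) (∉₃ T≢Y₁ T≢Y₂ T≢Y₃))

    preimageCount-Y : ∀ {β} → β ∈ Ys → preimageCount (F₃ c d) β ≡ 0
    preimageCount-Y (here refl) = preimageCount-by Y₁ (𝟙-no (0# ≟ Y₁) (≢-sym Y₁≢0)) (𝟙-no (0# ≟ Y₁) (≢-sym Y₁≢0))
                                    (𝟙-no (T ≟ Y₁) T≢Y₁) (𝟙-no (Y₁ ∉? Ys) (λ Y₁∉ → Y₁∉ (here refl)))
    preimageCount-Y (there (here refl)) = preimageCount-by Y₂ (𝟙-no (0# ≟ Y₂) (≢-sym Y₂≢0)) (𝟙-no (0# ≟ Y₂) (≢-sym Y₂≢0))
                                    (𝟙-no (T ≟ Y₂) T≢Y₂) (𝟙-no (Y₂ ∉? Ys) (λ Y₂∉ → Y₂∉ (there (here refl))))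
    preimageCount-Y (there (there (here refl))) = preimageCount-by Y₃ (𝟙-no (0# ≟ Y₃) (≢-sym Y₃≢0)) (𝟙-no (0# ≟ Y₃) (≢-sym Y₃≢0))
                                    (𝟙-no (T ≟ Y₃) T≢Y₃) (𝟙-no (Y₃ ∉? Ys) (λ Y₃∉ → Y₃∉ (there (there (here refl)))))

    preimageCount-other : ∀ {β} → β ∉ exceptional → preimageCount (F₃ c d) β ≡ 1
    preimageCount-other {β} β∉ = preimageCount-by β (𝟙-no (0# ≟ β) (β∉ ∘ here ∘ sym)) (𝟙-no (0# ≟ β) (β∉ ∘ here ∘ sym))
                                   (𝟙-no (T ≟ β) (β∉ ∘ there ∘ here ∘ sym)) (𝟙-yes (β ∉? Ys) (β∉ ∘ there ∘ there))

    preimageCount-cases : ∀ {k} β → preimageCount (F₃ c d) β ≡ k →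
                          (β ≡ 0# × k ≡ 3) ⊎ (β ≡ T × k ≡ 2) ⊎ (β ∈ Ys × k ≡ 0) ⊎ (β ∉ exceptional × k ≡ 1)
    preimageCount-cases β refl with β ∈? exceptional
    ... | yes (here refl) = inj₁ (refl , preimageCount-0)
    ... | yes (there (here refl)) = inj₂ (inj₁ (refl , preimageCount-T))
    ... | yes (there (there β∈Ys)) = inj₂ (inj₂ (inj₁ (β∈Ys , preimageCount-Y β∈Ys)))
    ... | no β∉ = inj₂ (inj₂ (inj₂ (β∉ , preimageCount-other β∉)))

    private
      count≢0 : ∀ β → InValueSet (F₃ c d) β → preimageCount (F₃ c d) β ≢ 0
      count≢0 β = Equivalence.to (InValueSet⇔preimageCount≢0 (F₃ c d) β)

    InValueSet⇔ : ∀ β → InValueSet (F₃ c d) β ⇔ (β ≢ Y₁ × β ≢ Y₂ × β ≢ Y₃)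
    InValueSet⇔ β = mk⇔ to from
      where
      to : InValueSet (F₃ c d) β → β ≢ Y₁ × β ≢ Y₂ × β ≢ Y₃
      to β∈V = (λ { refl → count≢0 β β∈V (preimageCount-Y (here refl)) })
             , (λ { refl → count≢0 β β∈V (preimageCount-Y (there (here refl))) })
             , (λ { refl → count≢0 β β∈V (preimageCount-Y (there (there (here refl)))) })
      from : β ≢ Y₁ × β ≢ Y₂ × β ≢ Y₃ → InValueSet (F₃ c d) β
      from (β≢Y₁ , β≢Y₂ , β≢Y₃) = Equivalence.from (InValueSet⇔preimageCount≢0 (F₃ c d) β) count≢0′
        where
        count≢0′ : preimageCount (F₃ c d) β ≢ 0
        count≢0′ c≡0 with preimageCount-cases β c≡0
        ... | inj₂ (inj₂ (inj₁ (β∈Ys , _))) = ∉₃ β≢Y₁ β≢Y₂ β≢Y₃ β∈Ys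

    exceptional! : Unique exceptional
    exceptional! = (≢-sym T≢0 ∷ ≢-sym Y₁≢0 ∷ ≢-sym Y₂≢0 ∷ ≢-sym Y₃≢0 ∷ []) ∷ (T≢Y₁ ∷ T≢Y₂ ∷ T≢Y₃ ∷ [])
                 ∷ (Y₁≢Y₂ ∷ Y₁≢Y₃ ∷ []) ∷ (Y₂≢Y₃ ∷ []) ∷ [] ∷ []

    preimageCount≡1 : ∀ β → InValueSet (F₃ c d) β → β ≢ T → β ≢ 0# → preimageCount (F₃ c d) β ≡ 1
    preimageCount≡1 β β∈V β≢T β≢0 with preimageCount-cases β refl
    ... | inj₁ (β≡0 , _) = ⊥-elim (β≢0 β≡0)
    ... | inj₂ (inj₁ (β≡T , _)) = ⊥-elim (β≢T β≡T)
    ... | inj₂ (inj₂ (inj₁ (β∈Ys , _))) = let (β≢Y₁ , β≢Y₂ , β≢Y₃) = Equivalence.to (InValueSet⇔ β) β∈V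
                                          in ⊥-elim (∉₃ β≢Y₁ β≢Y₂ β≢Y₃ β∈Ys)
    ... | inj₂ (inj₂ (inj₂ (_ , count≡1))) = count≡1

    preimageCount≡1⇒∉exceptional : ∀ β → preimageCount (F₃ c d) β ≡ 1 → β ∉ exceptional
    preimageCount≡1⇒∉exceptional β c≡1 with preimageCount-cases β c≡1
    ... | inj₂ (inj₂ (inj₂ (β∉ , _))) = β∉

    preimageCount≡0⇒∈Ys : ∀ β → preimageCount (F₃ c d) β ≡ 0 → β ∈ Ys
    preimageCount≡0⇒∈Ys β c≡0 with preimageCount-cases β c≡0
    ... | inj₂ (inj₂ (inj₁ (β∈Ys , _))) = β∈Ys

    preimageCount≡2⇒∈[T] : ∀ β → preimageCount (F₃ c d) β ≡ 2 → β ∈ T ∷ []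
    preimageCount≡2⇒∈[T] β c≡2 with preimageCount-cases β c≡2
    ... | inj₂ (inj₁ (β≡T , _)) = here β≡T
    ... | inj₂ (inj₂ (inj₁ (_ , ())))
    ... | inj₂ (inj₂ (inj₂ (_ , ())))

    preimageCount≡3⇒∈[0] : ∀ β → preimageCount (F₃ c d) β ≡ 3 → β ∈ 0# ∷ []
    preimageCount≡3⇒∈[0] β c≡3 with preimageCount-cases β c≡3
    ... | inj₁ (β≡0 , _) = here β≡0
    ... | inj₂ (inj₁ (_ , ()))
    ... | inj₂ (inj₂ (inj₁ (_ , ())))
    ... | inj₂ (inj₂ (inj₂ (_ , ())))

    preimageCount≤3 : ∀ β → preimageCount (F₃ c d) β ≤ 3
    preimageCount≤3 β with preimageCount-cases β refl
    ... | inj₁ (_ , c≡3) = ℕₚ.≤-reflexive c≡3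
    ... | inj₂ (inj₁ (_ , c≡2)) = subst (_≤ 3) (sym c≡2) (s≤s (s≤s z≤n))
    ... | inj₂ (inj₂ (inj₁ (_ , c≡0))) = subst (_≤ 3) (sym c≡0) z≤n
    ... | inj₂ (inj₂ (inj₂ (_ , c≡1))) = subst (_≤ 3) (sym c≡1) (s≤s z≤n)

    partIII : (∀ β → InValueSet (F₃ c d) β ⇔
                 (β ≢ d * (d + 1#) / c × β ≢ - ((d + 1#) * (d + 1#)) / c × β ≢ - (d * d) / c))
              × preimageCount (F₃ c d) ((- (d * d) - d - 1#) / c) ≡ 2
              × preimageCount (F₃ c d) 0# ≡ 3
              × (∀ β → InValueSet (F₃ c d) β → β ≢ (- (d * d) - d - 1#) / c → β ≢ 0#
                   → preimageCount (F₃ c d) β ≡ 1)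
              × numWithCount (F₃ c d) 1 ≡ q ∸ 5
              × maxCount (F₃ c d) ≡ 3
              × numWithCount (F₃ c d) 0 ≡ 3
              × numWithCount (F₃ c d) 2 ≡ 1
              × numWithCount (F₃ c d) 3 ≡ 1
    partIII = InValueSet⇔ , preimageCount-T , preimageCount-0 , preimageCount≡1
            , numWithCount≡q∸length (F₃ c d) exceptional! (λ β → mk⇔ (preimageCount≡1⇒∉exceptional β) preimageCount-other)
            , maxCount≡ (F₃ c d) preimageCount≤3 0# preimageCount-0
            , numWithCount≡length (F₃ c d) ((Y₁≢Y₂ ∷ Y₁≢Y₃ ∷ []) ∷ (Y₂≢Y₃ ∷ []) ∷ [] ∷ []) (λ β → mk⇔ (preimageCount≡0⇒∈Ys β) preimageCount-Y)
            , numWithCount≡length (F₃ c d) ([] ∷ []) (λ β → mk⇔ (preimageCount≡2⇒∈[T] β) λ { (here refl) → preimageCount-T })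
            , numWithCount≡length (F₃ c d) ([] ∷ []) (λ β → mk⇔ (preimageCount≡3⇒∈[0] β) λ { (here refl) → preimageCount-0 })

-- The prime-power hypothesis and the congruences in (i) and (ii) only guarantee that such d exist.
corollary6 : (K : FiniteField) → let open FF K in
  (∃₂ λ p k → Prime p × 1 ≤ k × q ≡ p ^ k) → q % 2 ≡ 1 → 5 ≤ q →
  (c : Carrier) → c ≢ 0# →
  -- (i)
  ((q % 3 ≡ 1) → (d : Carrier) → d * d + d + 1# ≡ 0# →
    let f = λ x → F₁ c d x - x
        g = λ x → - ((d + 1#) * x) + (d * d + d) / c
    in IsPermutation (F₁ c d)
       × (∀ x → x ≢ 0# → x ≢ (d + 1#) / c → x ≢ d / c → f x ≡ g x)
       × f 0# ≡ 0# × g (d / c) ≡ 0#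
       × f ((d + 1#) / c) ≡ g 0#
       × f (d / c) ≡ g ((d + 1#) / c))
  × -- (ii)
  ((q % 12 ≡ 5) → (d : Carrier) → (d + 1#) * (d + 1#) ≡ - 1# →
    (∀ β → InValueSet (F₁ c d) β ⇔ (β ≢ d / c × β ≢ (- d - (1# + 1#)) / c))
    × preimageCount (F₁ c d) (- 1# / c) ≡ 3
    × (∀ β → InValueSet (F₁ c d) β → β ≢ - 1# / c → preimageCount (F₁ c d) β ≡ 1)
    × maxCount (F₁ c d) ≡ 3)
  × -- (iii)
  ((q % 12 ≡ 11) → (d : Carrier) → d ≢ - 1# → d ≢ - (1# / (1# + 1#)) → d ≢ 0# →
    (∀ β → InValueSet (F₃ c d) β ⇔
       (β ≢ d * (d + 1#) / c × β ≢ - ((d + 1#) * (d + 1#)) / c × β ≢ - (d * d) / c))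
    × preimageCount (F₃ c d) ((- (d * d) - d - 1#) / c) ≡ 2
    × preimageCount (F₃ c d) 0# ≡ 3
    × (∀ β → InValueSet (F₃ c d) β → β ≢ (- (d * d) - d - 1#) / c → β ≢ 0#
         → preimageCount (F₃ c d) β ≡ 1)
    × numWithCount (F₃ c d) 1 ≡ q ∸ 5
    × maxCount (F₃ c d) ≡ 3
    × numWithCount (F₃ c d) 0 ≡ 3
    × numWithCount (F₃ c d) 2 ≡ 1
    × numWithCount (F₃ c d) 3 ≡ 1)
corollary6 K _ q-odd 5≤q c c≢0 =
    (λ _ d h → PartI.partI K 3≤q c c≢0 d h)
  , (λ _ d h → PartII.partII K 3≤q q-odd c c≢0 d h)
  , (λ q%12≡11 d d≢-1 d≢-1/2 d≢0 → PartIII.partIII K 3≤q q-odd q%12≡11 c c≢0 d d≢-1 d≢-1/2 d≢0)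
  where
  3≤q : 3 ≤ FiniteField.size K
  3≤q = ≤-trans (s≤s (s≤s (s≤s z≤n))) 5≤q
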